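{- A language $L$ is $\mathrm{REG}$-immune if and only if $L$ is infinite and, for every set $B$, every $1\mbox{ - }\mathrm{DLIN}$-m-quasireduction $f$ from $L$ to $B$, and every $u\in B$, the set $f^{ -1}(u)$ is finite.
   Context: $L$ is $\mathrm{REG}$-immune if $L$ is infinite and has no infinite regular subset. $1\mbox{ - }\mathrm{FLIN}(\mathrm{partial})$ is the class of single-valued partial functions $f$ for which there is a one-tape one-head off-line deterministic Turing machine (head moving in both directions, input written on the single tape between endmarkers) running in linear time that on input $x$ halts in an accepting state with $f(x)$ as the content of its tape whenever $f(x)$ is defined, and halts in a rejecting state when $f(x)$ is undefined. A $1\mbox{ - }\mathrm{DLIN}$-m-quasireduction from $L$ to $B$ is a partial function $f\in1\mbox{ - }\mathrm{FLIN}(\mathrm{partial})$ such that for every string $x$ for which $f(x)$ is defined, $x\in L$ iff $f(x)\in B$. -}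

module Defs where

open import Data.Nat using (ℕ; zero; suc; _*_; _≤_)
open import Data.Fin using (Fin; _≟_)
open import Data.List using (List; []; _∷_; _++_; map; reverse; length)
open import Data.List.Membership.Propositional using (_∈_)
open import Data.Maybe using (Maybe; just; nothing)
open import Data.Bool using (Bool; true; false; T)
open import Data.Product using (Σ; _×_; _,_; ∃)
open import Relation.Nullary using (¬_; yes; no)
open import Relation.Binary.PropositionalEquality using (_≡_; _≢_)

Word : ℕ → Set
Word k = List (Fin k)

Language : ℕ → Set₁
Language k = Word k → Set

Finite : ∀ {k} → Language k → Set
Finite {k} L = Σ (List (Word k)) λ xs → ∀ w → L w → w ∈ xs

Infinite : ∀ {k} → Language k → Set
Infinite L = ¬ Finite L

record DFA (k : ℕ) : Set where
  field
    nStates : ℕ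
    start   : Fin nStates
    trans   : Fin nStates → Fin k → Fin nStates
    final   : Fin nStates → Bool

runDFA : ∀ {k} (M : DFA k) → Fin (DFA.nStates M) → Word k → Fin (DFA.nStates M)
runDFA M s []       = s
runDFA M s (a ∷ w)  = runDFA M (DFA.trans M s a) w

langDFA : ∀ {k} → DFA k → Language k
langDFA M w = T (DFA.final M (runDFA M (DFA.start M) w))

_⊆L_ : ∀ {k} → Language k → Language k → Set
R ⊆L L = ∀ w → R w → L w

REG-immune : ∀ {k} → Language k → Set
REG-immune {k} L =
  Infinite L × ¬ (Σ (DFA k) λ M → (langDFA M ⊆L L) × Infinite (langDFA M))

-- One-tape one-head off-line deterministic Turing machines
-- input alphabet Fin k, output alphabet Fin m, auxiliary tape symbols Fin a

data Sym (k m a : ℕ) : Set where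
  blank : Sym k m a
  lend  : Sym k m a
  rend  : Sym k m a
  inp   : Fin k → Sym k m a
  outp  : Fin m → Sym k m a
  aux   : Fin a → Sym k m a

data Move : Set where
  left stay right : Move

record TM (k m a q : ℕ) : Set where
  field
    start    : Fin q
    accept   : Fin q
    reject   : Fin q
    acc≢rej  : accept ≢ reject
    δ        : Fin q → Sym k m a → Fin q × Sym k m a × Move

-- configuration: state, cells left of the head (nearest first), scanned
-- cell, cells right of the head.  Cells not represented are blank
-- (two-way infinite tape).
record Config (k m a q : ℕ) : Set where
  constructor cfg
  field
    state : Fin q
    lefts : List (Sym k m a)
    head  : Sym k m a
    rights : List (Sym k m a)

moveHead : ∀ {k m a q} → Fin q → List (Sym k m a) → Sym k m a → List (Sym k m a)
         → Move → Config k m a q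
moveHead p l h r stay = cfg p l h r
moveHead p [] h r left = cfg p [] blank (h ∷ r)
moveHead p (x ∷ l) h r left = cfg p l x (h ∷ r)
moveHead p l h [] right = cfg p (h ∷ l) blank []
moveHead p l h (x ∷ r) right = cfg p (h ∷ l) x r

isHalting : ∀ {k m a q} → TM k m a q → Fin q → Bool
isHalting M p with p ≟ TM.accept M | p ≟ TM.reject M
... | yes _ | _     = true
... | no _  | yes _ = true
... | no _  | no _  = false

step : ∀ {k m a q} → TM k m a q → Config k m a q → Config k m a q
step M c@(cfg p l h r) with isHalting M p
... | true  = c
... | false with TM.δ M p h
...   | (p' , h' , d) = moveHead p' l h' r d

run : ∀ {k m a q} → TM k m a q → ℕ → Config k m a q → Config k m a q
run M zero c    = c
run M (suc t) c = run M t (step M c)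

initConfig : ∀ {k m a q} → TM k m a q → Word k → Config k m a q
initConfig M x = cfg (TM.start M) [] lend (map inp x ++ (rend ∷ []))

outputs : ∀ {k m a} → List (Sym k m a) → Word m
outputs [] = []
outputs (outp g ∷ s) = g ∷ outputs s
outputs (_ ∷ s) = outputs s

content : ∀ {k m a q} → Config k m a q → Word m
content (cfg _ l h r) = outputs (reverse l ++ (h ∷ r))

Result : ∀ {k m a q} → TM k m a q → Config k m a q → Maybe (Word m) → Set
Result M c (just y) = (Config.state c ≡ TM.accept M) × (content c ≡ y)
Result M c nothing  = Config.state c ≡ TM.reject M

ComputesInLinTime : ∀ {k m a q} → TM k m a q → (Word k → Maybe (Word m)) → Set
ComputesInLinTime {k} M f =
  Σ ℕ λ c → ∀ (x : Word k) → Σ ℕ λ t →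
    (t ≤ c * suc (length x)) × Result M (run M t (initConfig M x)) (f x)

1-FLIN-partial : ∀ {k m} → (Word k → Maybe (Word m)) → Set
1-FLIN-partial {k} {m} f =
  Σ ℕ λ a → Σ ℕ λ q → Σ (TM k m a q) λ M → ComputesInLinTime M f

Quasireduction : ∀ {k m} → Language k → Language m → (Word k → Maybe (Word m)) → Set
Quasireduction {k} {m} L B f =
  1-FLIN-partial f ×
  (∀ (x : Word k) (y : Word m) → f x ≡ just y → (L x → B y) × (B y → L x))

preimage : ∀ {k m} → (Word k → Maybe (Word m)) → Word m → Language k
preimage f u x = f x ≡ just u

-- Let f be computed by a one-tape machine in time c (n + 1), and let f x = u with x long. The crossing
-- sequences at the n + 1 boundaries between the symbols of ¢x have total length at most c (n + 1), so
-- more than half of them have length at most 2c + 1. Together with the part of u written left of the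
-- boundary such a sequence takes boundedly many values, so two boundaries i < j carry the same one.
-- Cutting x = a b c at i and j, the cut-and-paste argument shows that the machine accepts every a bⁿ c
-- (n ≥ 1) with output u (nothing is written between the two boundaries). If L is REG-immune these words
-- form an infinite regular subset of L, a contradiction; hence every preimage of u consists of short
-- words. Conversely, a DFA recognising an infinite subset of L yields the quasireduction that maps its
-- language to the empty word and is undefined elsewhere, and that preimage is infinite.

module Submission where
open import Defs
open import Data.Nat using (ℕ)
open import Data.Product using (_×_)
open import Function.Bundles using (_⇔_)

module IntegerSteps where

  open import Data.Integer as Z using (ℤ; _+_; _-_; _<_; _≤_; 1ℤ)
  import Data.Integer.Properties as ZP
  open import Data.Integer.Tactic.RingSolver using (solve-∀)
  open import Relation.Nullary using (¬_)
  open import Relation.Binary.PropositionalEquality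
  open import Data.Empty using (⊥-elim)
  open import Data.Sum using (_⊎_; inj₁; inj₂)

  sucZ predZ : ℤ → ℤ
  sucZ = Z.suc
  predZ = Z.pred

  +-cancelʳ-≡ : ∀ p z δ → p + δ ≡ z + δ → p ≡ z
  +-cancelʳ-≡ p z δ e = trans (l p δ) (trans (cong (_- δ) e) (sym (l z δ)))
    where
    l : ∀ p δ → p ≡ (p + δ) - δ
    l = solve-∀

  +-cancelʳ-< : ∀ {p b} δ → p + δ < b + δ → p < b
  +-cancelʳ-< {p} {b} δ h = subst₂ _<_ (sym (l p δ)) (sym (l b δ)) (ZP.+-monoˡ-< (Z.- δ) h)
    where
    l : ∀ p δ → p ≡ (p + δ) + Z.- δ
    l = solve-∀

  suc-+ : ∀ z δ → sucZ z + δ ≡ sucZ (z + δ)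
  suc-+ z δ = l z δ
    where
    l : ∀ z δ → (1ℤ + z) + δ ≡ 1ℤ + (z + δ)
    l = solve-∀

  suc-injective : ∀ {x y} → sucZ x ≡ sucZ y → x ≡ y
  suc-injective {x} {y} e = trans (sym (ZP.pred-suc x)) (trans (cong predZ e) (ZP.pred-suc y))

  i<suc[i] : ∀ z → z < sucZ z
  i<suc[i] z = ZP.suc[i]≤j⇒i<j ZP.≤-refl

  pred[i]<i : ∀ z → predZ z < z
  pred[i]<i z = subst (predZ z <_) (ZP.suc-pred z) (i<suc[i] (predZ z))

  Near : ℤ → ℤ → Set
  Near z z' = (z' ≡ z) ⊎ (z' ≡ sucZ z) ⊎ (z' ≡ predZ z)

  near-<-≮⇒≡ : ∀ {z z' b} → Near z z' → z < b → ¬ z' < b → z' ≡ b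
  near-<-≮⇒≡ (inj₁ refl) h n = ⊥-elim (n h)
  near-<-≮⇒≡ {z} {z'} {b} (inj₂ (inj₁ refl)) h n = ZP.≤-antisym (ZP.i<j⇒suc[i]≤j h) (ZP.≮⇒≥ n)
  near-<-≮⇒≡ {z} (inj₂ (inj₂ refl)) h n = ⊥-elim (n (ZP.<-trans (pred[i]<i z) h))

  near-≮-<⇒suc≡ : ∀ {z z' b} → Near z z' → ¬ z < b → z' < b → sucZ z' ≡ b
  near-≮-<⇒suc≡ (inj₁ refl) n h = ⊥-elim (n h)
  near-≮-<⇒suc≡ {z} (inj₂ (inj₁ refl)) n h = ⊥-elim (n (ZP.<-trans (i<suc[i] z) h))
  near-≮-<⇒suc≡ {z} {z'} {b} (inj₂ (inj₂ refl)) n h =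
    ZP.≤-antisym (ZP.i<j⇒suc[i]≤j h) (subst (b ≤_) (sym (ZP.suc-pred z)) (ZP.≮⇒≥ n))

  suc≡⇒≮ : ∀ {z b b'} → sucZ z ≡ b → b' < b → ¬ z < b'
  suc≡⇒≮ {z} refl h1 = ZP.≤⇒≯ (subst (_ ≤_) (ZP.pred-suc z) (ZP.i<j⇒i≤pred[j] h1))

  ≮-mono : ∀ {z b b'} → b' < b → ¬ z < b → ¬ z < b'
  ≮-mono h1 n h2 = n (ZP.<-trans h2 h1)


open IntegerSteps

module Counting where

  open import Data.Nat as N using (ℕ; zero; suc; _+_; _*_; _≤_; _<_; _≤?_; s≤s; z≤n)
  import Data.Nat.Properties as NP
  open import Data.Nat.Tactic.RingSolver using (solve-∀)
  open import Data.Fin as F using (Fin; zero; suc)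
  import Data.Fin.Properties as FP
  open import Data.List using (List; []; _∷_; length; lookup; cartesianProductWith; allFin)
  open import Data.List.Membership.Propositional using (_∈_)
  open import Data.List.Membership.Propositional.Properties using (∈-cartesianProductWith⁺; ∈-allFin)
  open import Data.List.Relation.Unary.Any using (here; there; index)
  open import Data.List.Relation.Unary.Any.Properties using (lookup-index)
  open import Data.List.Relation.Unary.All as All using (All; []; _∷_)
  import Data.Product
  open import Data.Product using (Σ; _×_; _,_; proj₁; proj₂)
  open import Relation.Nullary using (¬_; yes; no)
  open import Relation.Binary.PropositionalEquality
  open import Data.Empty using (⊥-elim)

  wordsUpTo : (q D : ℕ) → List (List (Fin q))
  wordsUpTo q zero = [] ∷ []
  wordsUpTo q (suc D) = [] ∷ cartesianProductWith _∷_ (allFin q) (wordsUpTo q D)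

  ∈-wordsUpTo : ∀ {q} D (xs : List (Fin q)) → length xs ≤ D → xs ∈ wordsUpTo q D
  ∈-wordsUpTo zero [] h = here refl
  ∈-wordsUpTo (suc D) [] h = here refl
  ∈-wordsUpTo (suc D) (x ∷ xs) (s≤s h) = there (∈-cartesianProductWith⁺ _∷_ (∈-allFin x) (∈-wordsUpTo D xs h))

  sumBelow : (ℕ → ℕ) → ℕ → ℕ
  sumBelow g zero = 0
  sumBelow g (suc N) = sumBelow g N + g N

  data Descending : List ℕ → Set where
    []ᵈ : Descending []
    _∷ᵈ_ : ∀ {x xs} → All (_< x) xs → Descending xs → Descending (x ∷ xs)

  all-lookup : ∀ {P : ℕ → Set} {xs} → All P xs → (p : Fin (length xs)) → P (lookup xs p)
  all-lookup (px ∷ _) zero = px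
  all-lookup (_ ∷ pxs) (suc p) = all-lookup pxs p

  descending-lookup : ∀ {xs} → Descending xs → (p p' : Fin (length xs)) → p F.< p' → lookup xs p' < lookup xs p
  descending-lookup (a ∷ᵈ d) zero (suc p') lt = all-lookup a p'
  descending-lookup (a ∷ᵈ d) (suc p) (suc p') (s≤s lt) = descending-lookup d p p' lt

  module ShortLong (g : ℕ → ℕ) (D : ℕ) where
    shortIndices : ℕ → List ℕ
    shortIndices zero = []
    shortIndices (suc N) with g N ≤? D
    ... | yes _ = N ∷ shortIndices N
    ... | no _ = shortIndices N

    longCount : ℕ → ℕ
    longCount zero = 0
    longCount (suc N) with g N ≤? D
    ... | yes _ = longCount N
    ... | no _ = suc (longCount N)

    short+long≡ : ∀ N → length (shortIndices N) + longCount N ≡ N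
    short+long≡ zero = refl
    short+long≡ (suc N) with g N ≤? D
    ... | yes _ = cong suc (short+long≡ N)
    ... | no _ = trans (NP.+-suc _ _) (cong suc (short+long≡ N))

    longCount-weight : ∀ N → suc D * longCount N ≤ sumBelow g N
    longCount-weight zero = NP.≤-reflexive (NP.*-zeroʳ (suc D))
    longCount-weight (suc N) with g N ≤? D
    ... | yes _ = NP.≤-trans (longCount-weight N) (NP.m≤m+n _ _)
    ... | no n = subst (_≤ sumBelow g N + g N) (trans (NP.+-comm _ (suc D)) (sym (NP.*-suc (suc D) (longCount N))))
                   (NP.+-mono-≤ (longCount-weight N) (NP.≰⇒> n))

    shortIndices-bounded : ∀ N → All (λ i → (i < N) × (g i ≤ D)) (shortIndices N)
    shortIndices-bounded zero = []
    shortIndices-bounded (suc N) with g N ≤? D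
    ... | yes y = (NP.n<1+n N , y) ∷ All.map (Data.Product.map₁ NP.m<n⇒m<1+n) (shortIndices-bounded N)
    ... | no _ = All.map (Data.Product.map₁ NP.m<n⇒m<1+n) (shortIndices-bounded N)

    shortIndices-descending : ∀ N → Descending (shortIndices N)
    shortIndices-descending zero = []ᵈ
    shortIndices-descending (suc N) with g N ≤? D
    ... | yes _ = All.map proj₁ (shortIndices-bounded N) ∷ᵈ shortIndices-descending N
    ... | no _ = shortIndices-descending N

  most-indices-short : ∀ (g : ℕ → ℕ) c N → sumBelow g N ≤ c * N →
    N ≤ 2 * length (ShortLong.shortIndices g (suc (c + c)) N)
  most-indices-short g c N sb = NP.+-cancelʳ-≤ (2 * L) N (2 * S)
      (subst (N + 2 * L ≤_) (eq2 S L N (short+long≡ N)) (NP.+-monoʳ-≤ N 2L≤N))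
    where
    open ShortLong g (suc (c + c))
    S = length (shortIndices N)
    L = longCount N
    -- Each long index contributes more than 2c to the sum, which is at most c N.
    2L≤N : 2 * L ≤ N
    2L≤N = NP.*-cancelˡ-≤ (suc c) (subst (_≤ suc c * N) (eq1 c L)
              (NP.≤-trans (longCount-weight N) (NP.≤-trans sb (NP.*-monoˡ-≤ N (NP.n≤1+n c)))))
      where
      eq1 : ∀ c L → suc (suc (c + c)) * L ≡ suc c * (2 * L)
      eq1 = solve-∀
    eq2 : ∀ S L N → S + L ≡ N → N + N ≡ 2 * S + 2 * L
    eq2 S L N refl = solve2 S L
      where
      solve2 : ∀ S L → (S + L) + (S + L) ≡ 2 * S + 2 * L
      solve2 = solve-∀

  -- At least half of the N > 2 |U| indices are short, so two short ones share a key.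
  repeatedShortKey : ∀ {A : Set} (U : List A) (key : ℕ → A) (g : ℕ → ℕ) (c N : ℕ) →
         (∀ i → g i ≤ suc (c + c) → key i ∈ U) →
         sumBelow g N ≤ c * N →
         2 * length U < N →
         Σ ℕ λ i → Σ ℕ λ j → (i < j) × (j < N) × (key i ≡ key j)
  repeatedShortKey {A} U key g c N mem sb big = i , j , lt , jN , keq
    where
    open ShortLong g (suc (c + c))
    Is = shortIndices N
    U<S : length U < length Is
    U<S = NP.*-cancelˡ-< 2 (length U) (length Is) (NP.<-≤-trans big (most-indices-short g c N sb))
    prop = shortIndices-bounded N
    f : Fin (length Is) → Fin (length U)
    f p = index (mem (lookup Is p) (proj₂ (all-lookup prop p)))
    ph = FP.pigeonhole U<S f
    p = proj₁ ph
    p' = proj₁ (proj₂ ph)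
    p<p' = proj₁ (proj₂ (proj₂ ph))
    fe = proj₂ (proj₂ (proj₂ ph))
    i = lookup Is p'
    j = lookup Is p
    lt : i < j
    lt = descending-lookup (shortIndices-descending N) p p' p<p'
    jN : j < N
    jN = proj₁ (all-lookup prop p)
    keq : key i ≡ key j
    keq = trans (lookup-index (mem (lookup Is p') (proj₂ (all-lookup prop p'))))
            (trans (cong (lookup U) (sym fe)) (sym (lookup-index (mem (lookup Is p) (proj₂ (all-lookup prop p))))))

  sumBelow-zero : ∀ (g : ℕ → ℕ) N → (∀ i → i < N → g i ≡ 0) → sumBelow g N ≡ 0
  sumBelow-zero g zero h = refl
  sumBelow-zero g (suc N) h rewrite h N (NP.n<1+n N) | sumBelow-zero g N (λ i l → h i (NP.m<n⇒m<1+n l)) = refl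

  zero-before-unique : ∀ (g : ℕ → ℕ) N → (∀ i j → ¬ g i ≡ 0 → ¬ g j ≡ 0 → i ≡ j) → ¬ g N ≡ 0 → ∀ i → i < N → g i ≡ 0
  zero-before-unique g N u ne i l with g i N.≟ 0
  ... | yes e = e
  ... | no ne' = ⊥-elim (NP.<-irrefl (u i N ne' ne) l)

  sumBelow-≤1 : ∀ (g : ℕ → ℕ) N → (∀ i → g i ≤ 1) → (∀ i j → ¬ g i ≡ 0 → ¬ g j ≡ 0 → i ≡ j) → sumBelow g N ≤ 1
  sumBelow-≤1 g zero b u = z≤n
  sumBelow-≤1 g (suc N) b u with g N N.≟ 0
  ... | yes e rewrite e | NP.+-identityʳ (sumBelow g N) = sumBelow-≤1 g N b u
  ... | no ne rewrite sumBelow-zero g N (zero-before-unique g N u ne) = b N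

  sumBelow-+ : ∀ (f g : ℕ → ℕ) N → sumBelow (λ i → f i + g i) N ≡ sumBelow f N + sumBelow g N
  sumBelow-+ f g zero = refl
  sumBelow-+ f g (suc N) rewrite sumBelow-+ f g N = l (sumBelow f N) (sumBelow g N) (f N) (g N)
    where
    l : ∀ a b c d → (a + b) + (c + d) ≡ (a + c) + (b + d)
    l = solve-∀

  sumBelow-cong : ∀ (f g : ℕ → ℕ) N → (∀ i → f i ≡ g i) → sumBelow f N ≡ sumBelow g N
  sumBelow-cong f g zero h = refl
  sumBelow-cong f g (suc N) h = cong₂ _+_ (sumBelow-cong f g N h) (h N)


open Counting

module TapeMachine where

  open import Defs
  open IntegerSteps
  open import Data.Nat as N using (ℕ; zero; suc)
  import Data.Nat.Properties as NP
  import Data.Sum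
  open import Data.Integer as Z using (ℤ; _+_; _<_; _≤_; +_)
  open import Data.Integer.Properties as ZP using (_<?_; _≟_)
  open import Data.Fin using (Fin)
  open import Data.List using (List; []; _∷_; _++_; length)
  open import Data.List.Properties using (++-conicalˡ; ++-conicalʳ; ++-assoc; length-++; ∷-injectiveˡ)
  open Counting using (sumBelow; sumBelow-≤1; sumBelow-zero; sumBelow-+; sumBelow-cong)
  open import Data.Bool using (Bool; true; false; if_then_else_)
  open import Data.Product using (Σ; _×_; _,_; proj₁; proj₂)
  open import Data.Sum using (_⊎_; inj₁; inj₂)
  open import Data.Empty using (⊥; ⊥-elim)
  open import Relation.Nullary using (¬_; yes; no; does; Dec)
  open import Relation.Binary.PropositionalEquality

  -- The semantics of Defs on a tape indexed by ℤ with an absolute head position, so that tapes can be cut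
  -- and glued at a fixed boundary; the module Zipper below relates it to the list-based configurations.
  module IntegerTape {k m a q : ℕ} (M : TM k m a q) where
    open TM M

    S : Set
    S = Sym k m a

    Tape : Set
    Tape = ℤ → S

    record TapeConfig : Set where
      constructor pc
      field
        st : Fin q
        tp : Tape
        hd : ℤ
    open TapeConfig public

    write : Tape → ℤ → S → Tape
    write T z s p with p ≟ z
    ... | yes _ = s
    ... | no _ = T p

    mv : Move → ℤ → ℤ
    mv left z = predZ z
    mv stay z = z
    mv right z = sucZ z

    act : Tape → ℤ → Fin q × S × Move → TapeConfig
    act T z (p' , s , d) = pc p' (write T z s) (mv d z)

    tstep : TapeConfig → TapeConfig
    tstep (pc p T z) = if isHalting M p then pc p T z else act T z (δ p (T z))

    trun : ℕ → TapeConfig → TapeConfig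
    trun zero c = c
    trun (suc t) c = trun t (tstep c)

    Halted : TapeConfig → Set
    Halted c = isHalting M (st c) ≡ true

    _≈_ : TapeConfig → TapeConfig → Set
    c ≈ d = (st c ≡ st d) × (hd c ≡ hd d) × (∀ p → tp c p ≡ tp d p)

    ≈-refl : ∀ {c} → c ≈ c
    ≈-refl = refl , refl , λ _ → refl

    ≈-trans : ∀ {c d e} → c ≈ d → d ≈ e → c ≈ e
    ≈-trans (e1 , e2 , e3) (f1 , f2 , f3) = trans e1 f1 , trans e2 f2 , λ p → trans (e3 p) (f3 p)

    write-cong : ∀ {T T'} → (∀ p → T p ≡ T' p) → ∀ z s p → write T z s p ≡ write T' z s p
    write-cong e z s p with p ≟ z
    ... | yes _ = refl
    ... | no _ = e p

    write-other : ∀ T z s p → ¬ p ≡ z → write T z s p ≡ T p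
    write-other T z s p n with p ≟ z
    ... | yes e = ⊥-elim (n e)
    ... | no _ = refl

    write-same : ∀ T z s → write T z s z ≡ s
    write-same T z s with z ≟ z
    ... | yes _ = refl
    ... | no n = ⊥-elim (n refl)

    tstep-cong : ∀ c d → c ≈ d → tstep c ≈ tstep d
    tstep-cong (pc p T z) (pc .p T' .z) (refl , refl , e) with isHalting M p
    ... | true = refl , refl , e
    ... | false rewrite e z with δ p (T' z)
    ... | (p' , s , d) = refl , refl , write-cong e z s

    trun-cong : ∀ t c d → c ≈ d → trun t c ≈ trun t d
    trun-cong zero c d e = e
    trun-cong (suc t) c d e = trun-cong t (tstep c) (tstep d) (tstep-cong c d e)

    trun-+ : ∀ t1 t2 c → trun (t1 N.+ t2) c ≡ trun t2 (trun t1 c)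
    trun-+ zero t2 c = refl
    trun-+ (suc t1) t2 c = trun-+ t1 t2 (tstep c)

    tstep-halted : ∀ c → Halted c → tstep c ≡ c
    tstep-halted (pc p T z) h rewrite h = refl

    trun-halted : ∀ t c → Halted c → trun t c ≡ c
    trun-halted zero c h = refl
    trun-halted (suc t) c h rewrite tstep-halted c h = trun-halted t c h

    halted-unique : ∀ t1 t2 c → Halted (trun t1 c) → Halted (trun t2 c) → trun t1 c ≡ trun t2 c
    halted-unique zero t2 c h1 h2 = sym (trun-halted t2 c h1)
    halted-unique (suc t1) zero c h1 h2 = trun-halted (suc t1) c h2
    halted-unique (suc t1) (suc t2) c h1 h2 = halted-unique t1 t2 (tstep c) h1 h2

    tstep-near : ∀ c → Near (hd c) (hd (tstep c))
    tstep-near (pc p T z) with isHalting M p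
    ... | true = inj₁ refl
    ... | false with δ p (T z)
    ... | (p' , s , left) = inj₂ (inj₂ refl)
    ... | (p' , s , stay) = inj₁ refl
    ... | (p' , s , right) = inj₂ (inj₁ refl)

    tstep-tape-elsewhere : ∀ c p → ¬ p ≡ hd c → tp (tstep c) p ≡ tp c p
    tstep-tape-elsewhere (pc p0 T z) p n with isHalting M p0
    ... | true = refl
    ... | false with δ p0 (T z)
    ... | (p' , s , d) = write-other T z s p n

    -- Boundary b separates cell b - 1 from cell b; the crossing sequence at b lists the states
    -- in which the head has just crossed it.
    leftOf : ℤ → ℤ → Bool
    leftOf b z = does (z <? b)

    differ : Bool → Bool → Bool
    differ true false = true
    differ false true = true
    differ _ _ = false

    crossMark : Bool → Bool → Fin q → List (Fin q)
    crossMark x y s = if differ x y then s ∷ [] else []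

    crossingAt : ℤ → TapeConfig → List (Fin q)
    crossingAt b c = crossMark (leftOf b (hd c)) (leftOf b (hd (tstep c))) (st (tstep c))

    crossingSeq : ℤ → TapeConfig → ℕ → List (Fin q)
    crossingSeq b c zero = []
    crossingSeq b c (suc t) = crossingAt b c ++ crossingSeq b (tstep c) t

    crossingSeq-+ : ∀ b t1 t2 c → crossingSeq b c (t1 N.+ t2) ≡ crossingSeq b c t1 ++ crossingSeq b (trun t1 c) t2
    crossingSeq-+ b zero t2 c = refl
    crossingSeq-+ b (suc t1) t2 c rewrite crossingSeq-+ b t1 t2 (tstep c) = sym (++-assoc (crossingAt b c) _ _)

    data CrossingView (b : ℤ) (c : TapeConfig) : Set where
      noCross : crossingAt b c ≡ [] → leftOf b (hd (tstep c)) ≡ leftOf b (hd c) → CrossingView b c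
      cross : crossingAt b c ≡ st (tstep c) ∷ [] → ¬ leftOf b (hd (tstep c)) ≡ leftOf b (hd c) → CrossingView b c

    crossingView : ∀ b c → CrossingView b c
    crossingView b c = go (leftOf b (hd c)) (leftOf b (hd (tstep c))) refl refl
      where
      go : ∀ x y → leftOf b (hd c) ≡ x → leftOf b (hd (tstep c)) ≡ y → CrossingView b c
      E : ∀ {x y} → leftOf b (hd c) ≡ x → leftOf b (hd (tstep c)) ≡ y → crossingAt b c ≡ crossMark x y (st (tstep c))
      E e1 e2 = cong₂ (λ x y → crossMark x y (st (tstep c))) e1 e2
      go true true e1 e2 = noCross (E e1 e2) (trans e2 (sym e1))
      go true false e1 e2 = cross (E e1 e2) (λ h → case (trans (sym e2) (trans h e1)))
        where case : false ≡ true → ⊥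
              case ()
      go false true e1 e2 = cross (E e1 e2) (λ h → case (trans (sym e2) (trans h e1)))
        where case : true ≡ false → ⊥
              case ()
      go false false e1 e2 = noCross (E e1 e2) (trans e2 (sym e1))

    leftOf-true : ∀ {b z} → leftOf b z ≡ true → z < b
    leftOf-true {b} {z} h with z <? b
    ... | yes p = p
    ... | no _ with h
    ... | ()

    leftOf-false : ∀ {b z} → leftOf b z ≡ false → ¬ z < b
    leftOf-false {b} {z} h with z <? b
    ... | no p = p
    ... | yes _ with h
    ... | ()

    <⇒leftOf : ∀ {b z} → z < b → leftOf b z ≡ true
    <⇒leftOf {b} {z} h with z <? b
    ... | yes _ = refl
    ... | no n = ⊥-elim (n h)

    ≮⇒leftOf : ∀ {b z} → ¬ z < b → leftOf b z ≡ false
    ≮⇒leftOf {b} {z} h with z <? b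
    ... | yes p = ⊥-elim (h p)
    ... | no _ = refl

    leftOf-≢ : ∀ {b p z} → ¬ leftOf b p ≡ leftOf b z → ¬ p ≡ z
    leftOf-≢ n refl = n refl

    noCrossing-frozen : ∀ b t c → crossingSeq b c t ≡ [] →
             (leftOf b (hd (trun t c)) ≡ leftOf b (hd c)) × (∀ p → ¬ leftOf b p ≡ leftOf b (hd c) → tp (trun t c) p ≡ tp c p)
    noCrossing-frozen b zero c h = refl , λ _ _ → refl
    noCrossing-frozen b (suc t) c h with crossingView b c
    ... | cross e _ with trans (sym e) (++-conicalˡ (crossingAt b c) _ h)
    ... | ()
    noCrossing-frozen b (suc t) c h | noCross e s with noCrossing-frozen b t (tstep c) (++-conicalʳ (crossingAt b c) _ h)
    ... | (s1 , f1) = trans s1 s , λ p n → trans (f1 p (λ x → n (trans x s))) (tstep-tape-elsewhere c p (leftOf-≢ n))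

    firstCrossing : ∀ b t c s rest → crossingSeq b c t ≡ s ∷ rest →
      Σ ℕ λ t1 → Σ ℕ λ t2 → (t ≡ t1 N.+ suc t2) × (crossingSeq b c t1 ≡ []) ×
        (crossingAt b (trun t1 c) ≡ s ∷ []) × (crossingSeq b (tstep (trun t1 c)) t2 ≡ rest)
    firstCrossing b zero c s rest ()
    firstCrossing b (suc t) c s rest h with crossingView b c
    ... | cross e _ rewrite e with h
    ... | refl = 0 , t , refl , refl , e , refl
    firstCrossing b (suc t) c s rest h | noCross e _ rewrite e with firstCrossing b t (tstep c) s rest h
    ... | (t1 , t2 , e1 , e2 , e3 , e4) = suc t1 , t2 , cong suc e1 , trans (cong (_++ crossingSeq b (tstep c) t1) e) e2 , e3 , e4


    glue : ℤ → ℤ → Tape → Tape → Tape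
    glue b sh T1 T2 p with p <? b
    ... | yes _ = T1 p
    ... | no _ = T2 (p + sh)

    glue-l : ∀ b sh T1 T2 p → p < b → glue b sh T1 T2 p ≡ T1 p
    glue-l b sh T1 T2 p h with p <? b
    ... | yes _ = refl
    ... | no n = ⊥-elim (n h)

    glue-r : ∀ b sh T1 T2 p → ¬ p < b → glue b sh T1 T2 p ≡ T2 (p + sh)
    glue-r b sh T1 T2 p h with p <? b
    ... | yes y = ⊥-elim (h y)
    ... | no n = refl

    glue-cong : ∀ b sh {T1 T1' T2 T2'} → (∀ p → p < b → T1 p ≡ T1' p) →
                (∀ p → ¬ p < b → T2 (p + sh) ≡ T2' (p + sh)) → ∀ p → glue b sh T1 T2 p ≡ glue b sh T1' T2' p
    glue-cong b sh e1 e2 p with p <? b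
    ... | yes y = e1 p y
    ... | no n = e2 p n

    mv-shift : ∀ d z sh → mv d z + sh ≡ mv d (z + sh)
    mv-shift left z sh = ZP.pred-+ z sh
    mv-shift stay z sh = refl
    mv-shift right z sh = suc-+ z sh

    step-glueˡ : ∀ bx sh X TY → hd X < bx →
      tstep (pc (st X) (glue bx sh (tp X) TY) (hd X)) ≈ pc (st (tstep X)) (glue bx sh (tp (tstep X)) TY) (hd (tstep X))
    step-glueˡ bx sh (pc p T z) TY h with isHalting M p
    ... | true = ≈-refl
    ... | false rewrite glue-l bx sh T TY z h with δ p (T z)
    ... | (p' , s , d) = refl , refl , gw
      where
      gw : ∀ p0 → write (glue bx sh T TY) z s p0 ≡ glue bx sh (write T z s) TY p0
      gw p0 with p0 ≟ z
      ... | yes refl = sym (trans (glue-l bx sh (write T z s) TY z h) (write-same T z s))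
      ... | no n with p0 <? bx
      ... | yes y = sym (write-other T z s p0 n)
      ... | no _ = refl

    step-glueʳ : ∀ bx sh Y TX z → ¬ z < bx → z + sh ≡ hd Y →
      Σ ℤ λ z' → (tstep (pc (st Y) (glue bx sh TX (tp Y)) z) ≈ pc (st (tstep Y)) (glue bx sh TX (tp (tstep Y))) z') ×
                 (z' + sh ≡ hd (tstep Y))
    step-glueʳ bx sh (pc p T .(z + sh)) TX z h refl with isHalting M p
    ... | true = z , ≈-refl , refl
    ... | false rewrite glue-r bx sh TX T z h with δ p (T (z + sh))
    ... | (p' , s , d) = mv d z , (refl , refl , gw) , mv-shift d z sh
      where
      gw : ∀ p0 → write (glue bx sh TX T) z s p0 ≡ glue bx sh TX (write T (z + sh) s) p0
      gw p0 with p0 <? bx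
      ... | yes y = trans (write-other (glue bx sh TX T) z s p0 (λ e → h (subst (_< bx) e y))) (glue-l bx sh TX T p0 y)
      ... | no n with p0 ≟ z
      ... | yes refl = sym (write-same T (z + sh) s)
      ... | no ne = trans (glue-r bx sh TX T p0 n) (sym (write-other T (z + sh) s (p0 + sh) (λ e → ne (+-cancelʳ-≡ p0 z sh e))))

    crossingAt-≡ : ∀ b c d → hd c ≡ hd d → hd (tstep c) ≡ hd (tstep d) → st (tstep c) ≡ st (tstep d) → crossingAt b c ≡ crossingAt b d
    crossingAt-≡ b c d e1 e2 e3 = cong₃ e1 e2 e3
      where
      cong₃ : hd c ≡ hd d → hd (tstep c) ≡ hd (tstep d) → st (tstep c) ≡ st (tstep d) → crossingAt b c ≡ crossingAt b d
      cong₃ e1 e2 e3 rewrite e1 | e2 | e3 = refl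

    crossingAt-≮ : ∀ b c → ¬ hd c < b → ¬ hd (tstep c) < b → crossingAt b c ≡ []
    crossingAt-≮ b c n1 n2 = cong₂ (λ x y → crossMark x y (st (tstep c))) (≮⇒leftOf n1) (≮⇒leftOf n2)

    noCrossing-right : ∀ bx b t c → crossingSeq bx c t ≡ [] → ¬ hd c < bx → b < bx → crossingSeq b c t ≡ []
    noCrossing-right bx b zero c h n lt = refl
    noCrossing-right bx b (suc t) c h n lt with crossingView bx c
    ... | cross e _ with trans (sym e) (++-conicalˡ (crossingAt bx c) _ h)
    ... | ()
    noCrossing-right bx b (suc t) c h n lt | noCross e s =
      cong₂ _++_ (crossingAt-≮ b c (≮-mono lt n) (≮-mono lt n'))
                 (noCrossing-right bx b t (tstep c) (++-conicalʳ (crossingAt bx c) _ h) n' lt)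
      where
      n' : ¬ hd (tstep c) < bx
      n' = leftOf-false (trans s (≮⇒leftOf n))

    false≢true : false ≡ true → ⊥
    false≢true ()

    sides-≮< : ∀ {b p z} → ¬ p < b → z < b → ¬ leftOf b p ≡ leftOf b z
    sides-≮< n h e = false≢true (trans (sym (≮⇒leftOf n)) (trans e (<⇒leftOf h)))

    sides-<≮ : ∀ {b p z} → p < b → ¬ z < b → ¬ leftOf b p ≡ leftOf b z
    sides-<≮ h n e = false≢true (trans (sym (≮⇒leftOf n)) (trans (sym e) (<⇒leftOf h)))

    budgetˡ : ∀ Tx t1 t2 n → suc Tx N.+ (t1 N.+ suc t2) N.≤ suc n → Tx N.+ t2 N.≤ n
    budgetˡ Tx t1 t2 n h = NP.≤-trans (NP.+-monoʳ-≤ Tx (NP.≤-trans (NP.n≤1+n t2) (NP.m≤n+m (suc t2) t1))) (NP.≤-pred h)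

    budgetʳ : ∀ Tx Ty n → Tx N.+ suc Ty N.≤ suc n → Tx N.+ Ty N.≤ n
    budgetʳ Tx Ty n h rewrite NP.+-suc Tx Ty = NP.≤-pred h

    budgetˡʳ : ∀ t1 t2 Ty n → (t1 N.+ suc t2) N.+ suc Ty N.≤ suc n → t2 N.+ Ty N.≤ n
    budgetˡʳ t1 t2 Ty n h rewrite NP.+-suc (t1 N.+ suc t2) Ty =
      NP.≤-trans (NP.+-monoˡ-≤ Ty (NP.≤-trans (NP.n≤1+n t2) (NP.m≤n+m (suc t2) t1))) (NP.≤-pred h)

    sides-< : ∀ {b x y} → ¬ leftOf b x ≡ leftOf b y → y < b → ¬ x < b
    sides-< s l lx = s (trans (<⇒leftOf lx) (sym (<⇒leftOf l)))

    sides-≮ : ∀ {b x y} → ¬ leftOf b x ≡ leftOf b y → ¬ y < b → x < b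
    sides-≮ {b} {x} s ny with x <? b
    ... | yes l = l
    ... | no nx = ⊥-elim (s (sym (≮⇒leftOf ny)))

    rightExcursion-crossingSeq : ∀ bx b t1 t2 X → ¬ hd X < bx → crossingSeq bx X t1 ≡ [] →
      ¬ leftOf bx (hd (tstep (trun t1 X))) ≡ leftOf bx (hd (trun t1 X)) → b < bx →
      crossingSeq b X (t1 N.+ suc t2) ≡ crossingSeq b (tstep (trun t1 X)) t2
    rightExcursion-crossingSeq bx b t1 t2 X hX c1 s' lt = trans (crossingSeq-+ b t1 (suc t2) X)
      (cong₂ _++_ (noCrossing-right bx b t1 X c1 hX lt)
        (cong (_++ crossingSeq b (tstep X1) t2)
          (crossingAt-≮ b X1 (≮-mono lt nX1) (suc≡⇒≮ (near-≮-<⇒suc≡ (tstep-near X1) nX1 (sides-≮ s' nX1)) lt))))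
      where
      X1 = trun t1 X
      nX1 : ¬ hd X1 < bx
      nX1 = leftOf-false (trans (proj₁ (noCrossing-frozen bx t1 X c1)) (≮⇒leftOf hX))

    -- Cut and paste: if X crosses bx with the same crossing sequence as Y crosses by, the run C on the
    -- glued tape behaves like X left of bx and like Y (translated by sh) right of it, switching at each
    -- crossing; the invariants LeftInv and RightInv record which run C currently follows.
    module CutAndPaste (bx by sh : ℤ) (eb : bx + sh ≡ by) where
      R< : ∀ {p} → ¬ p < bx → ¬ p + sh < by
      R< {p} n h = n (+-cancelʳ-< sh (subst (p + sh <_) (sym eb) h))
      L< : ∀ {p} → p < bx → p + sh < by
      L< {p} h = subst (p + sh <_) eb (ZP.+-monoˡ-< sh h)
      R<' : ∀ {p} → ¬ p + sh < by → ¬ p < bx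
      R<' n h = n (L< h)

      PastedRun : TapeConfig → TapeConfig → TapeConfig → ℕ → ℕ → Set
      PastedRun C X Y Tx Ty = Σ ℕ λ T → Halted (trun T C) ×
        ((st (trun T C) ≡ st (trun Tx X)) ⊎ (st (trun T C) ≡ st (trun Ty Y))) ×
        (∀ p → tp (trun T C) p ≡ glue bx sh (tp (trun Tx X)) (tp (trun Ty Y)) p) ×
        (∀ b → b < bx → crossingSeq b C T ≡ crossingSeq b X Tx)

      LeftInv RightInv : TapeConfig → TapeConfig → TapeConfig → Set
      LeftInv C X Y = (C ≈ pc (st X) (glue bx sh (tp X) (tp Y)) (hd X)) × (hd X < bx) × (hd Y < by)
      RightInv C X Y = (C ≈ pc (st Y) (glue bx sh (tp X) (tp Y)) (hd C)) × (hd C + sh ≡ hd Y) × (¬ hd X < bx) × (¬ hd Y < by)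

      handoverˡ : ∀ {C X Y} t1 → LeftInv C X Y →
        ¬ leftOf bx (hd (tstep X)) ≡ leftOf bx (hd X) → crossingSeq by Y t1 ≡ [] →
        st (tstep (trun t1 Y)) ≡ st (tstep X) →
        ¬ leftOf by (hd (tstep (trun t1 Y))) ≡ leftOf by (hd (trun t1 Y)) →
        RightInv (tstep C) (tstep X) (tstep (trun t1 Y))
      handoverˡ {C} {X} {Y} t1 (inv , hX , hY) s c1 stY s' =
        (trans (proj₁ eqv) (sym stY) , refl , λ p → trans (proj₂ (proj₂ eqv) p) (glue-cong bx sh (λ _ _ → refl) tpY p)) ,
        trans (cong (_+ sh) (trans (proj₁ (proj₂ eqv)) exX)) (trans eb (sym exY)) , nX' , nY2
        where
        Y1 = trun t1 Y
        fr = noCrossing-frozen by t1 Y c1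
        hY1 : hd Y1 < by
        hY1 = leftOf-true (trans (proj₁ fr) (<⇒leftOf hY))
        nY2 : ¬ hd (tstep Y1) < by
        nY2 = sides-< s' hY1
        nX' : ¬ hd (tstep X) < bx
        nX' = sides-< s hX
        exY : hd (tstep Y1) ≡ by
        exY = near-<-≮⇒≡ (tstep-near Y1) hY1 nY2
        exX : hd (tstep X) ≡ bx
        exX = near-<-≮⇒≡ (tstep-near X) hX nX'
        eqv = ≈-trans (tstep-cong C _ inv) (step-glueˡ bx sh X (tp Y) hX)
        tpY : ∀ p → ¬ p < bx → tp Y (p + sh) ≡ tp (tstep Y1) (p + sh)
        tpY p n = sym (trans (tstep-tape-elsewhere Y1 (p + sh) (λ eq → R< n (subst (_< by) (sym eq) hY1)))
                             (proj₂ fr (p + sh) (sides-≮< (R< n) hY)))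

      re-entry : ∀ {z Y} → ¬ hd Y < by → z + sh ≡ hd (tstep Y) →
        ¬ leftOf by (hd (tstep Y)) ≡ leftOf by (hd Y) → sucZ z ≡ bx
      re-entry {z} {Y} hY ez s = +-cancelʳ-≡ (sucZ z) bx sh
        (trans (suc-+ z sh) (trans (cong sucZ ez) (trans (near-≮-<⇒suc≡ (tstep-near Y) hY (sides-≮ s hY)) (sym eb))))

      handoverʳ : ∀ {C X Y z'} t1 → ¬ hd X < bx → ¬ hd Y < by →
        tstep C ≈ pc (st (tstep Y)) (glue bx sh (tp X) (tp (tstep Y))) z' → sucZ z' ≡ bx →
        ¬ leftOf by (hd (tstep Y)) ≡ leftOf by (hd Y) → crossingSeq bx X t1 ≡ [] →
        st (tstep (trun t1 X)) ≡ st (tstep Y) →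
        ¬ leftOf bx (hd (tstep (trun t1 X))) ≡ leftOf bx (hd (trun t1 X)) →
        LeftInv (tstep C) (tstep (trun t1 X)) (tstep Y)
      handoverʳ {C} {X} {Y} t1 hX hY eqv back s c1 stX s' =
        (trans (proj₁ eqv) (sym stX) , hdEq , λ p → trans (proj₂ (proj₂ eqv) p) (glue-cong bx sh tpX (λ _ _ → refl) p)) ,
        hX2 , sides-≮ s hY
        where
        X1 = trun t1 X
        frX = noCrossing-frozen bx t1 X c1
        nX1 : ¬ hd X1 < bx
        nX1 = leftOf-false (trans (proj₁ frX) (≮⇒leftOf hX))
        hX2 : hd (tstep X1) < bx
        hX2 = sides-≮ s' nX1
        hdEq : hd (tstep C) ≡ hd (tstep X1)
        hdEq = trans (proj₁ (proj₂ eqv)) (suc-injective (trans back (sym (near-≮-<⇒suc≡ (tstep-near X1) nX1 hX2))))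
        tpX : ∀ p → p < bx → tp X p ≡ tp (tstep X1) p
        tpX p l = sym (trans (tstep-tape-elsewhere X1 p (λ eq → nX1 (subst (_< bx) eq l))) (proj₂ frX p (sides-<≮ l hX)))

      pasteˡ : ∀ n C X Y Tx Ty → Tx N.+ Ty N.≤ n → LeftInv C X Y → Halted (trun Tx X) → Halted (trun Ty Y) →
              crossingSeq bx X Tx ≡ crossingSeq by Y Ty → PastedRun C X Y Tx Ty
      pasteʳ : ∀ n C X Y Tx Ty → Tx N.+ Ty N.≤ n → RightInv C X Y → Halted (trun Tx X) → Halted (trun Ty Y) →
              crossingSeq bx X Tx ≡ crossingSeq by Y Ty → PastedRun C X Y Tx Ty

      pasteˡ n C X Y zero Ty bnd (inv , hX , hY) HX HY E =
        0 , subst (λ s → isHalting M s ≡ true) (sym (proj₁ inv)) HX , inj₁ (proj₁ inv) , tapeEq , λ b _ → refl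
        where
        fr = noCrossing-frozen by Ty Y (sym E)
        tapeEq : ∀ p → tp C p ≡ glue bx sh (tp X) (tp (trun Ty Y)) p
        tapeEq p = trans (proj₂ (proj₂ inv) p)
          (glue-cong bx sh (λ _ _ → refl) (λ p n → sym (proj₂ fr (p + sh) (sides-≮< (R< n) hY))) p)
      pasteˡ zero C X Y (suc Tx) Ty () inv HX HY E
      pasteˡ (suc n) C X Y (suc Tx) Ty bnd (inv , hX , hY) HX HY E with crossingView bx X
      ... | noCross e s with pasteˡ n (tstep C) (tstep X) Y Tx Ty (NP.≤-pred bnd) invX' HX HY E'
        where
        eqv = ≈-trans (tstep-cong C _ inv) (step-glueˡ bx sh X (tp Y) hX)
        invX' = eqv , leftOf-true (trans s (<⇒leftOf hX)) , hY
        E' = trans (cong (_++ crossingSeq bx (tstep X) Tx) (sym e)) E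
      ... | (T , h , stE , tpE , csE) = suc T , h , stE , tpE , λ b lt → cong₂ _++_ (crossingAt-≡ b C X (proj₁ (proj₂ inv)) (proj₁ (proj₂ eqv)) (proj₁ eqv)) (csE b lt)
        where
        eqv = ≈-trans (tstep-cong C _ inv) (step-glueˡ bx sh X (tp Y) hX)
      pasteˡ (suc n) C X Y (suc Tx) Ty bnd (inv , hX , hY) HX HY E | cross e s
        with firstCrossing by Ty Y (st (tstep X)) (crossingSeq bx (tstep X) Tx) (sym (trans (cong (_++ crossingSeq bx (tstep X) Tx) (sym e)) E))
      ... | (t1 , t2 , refl , c1 , tk1 , c2) with crossingView by (trun t1 Y)
      ... | noCross e' _ with trans (sym e') tk1
      ... | ()
      pasteˡ (suc n) C X Y (suc Tx) Ty bnd (inv , hX , hY) HX HY E | cross e s | (t1 , t2 , refl , c1 , tk1 , c2) | cross e' s'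
        with pasteʳ n (tstep C) (tstep X) (tstep (trun t1 Y)) Tx t2 (budgetˡ Tx t1 t2 n bnd)
               (handoverˡ {C} {X} {Y} t1 (inv , hX , hY) s c1 (∷-injectiveˡ (trans (sym e') tk1)) s')
               HX (subst Halted (trun-+ t1 (suc t2) Y) HY) (sym c2)
      ... | (T , h , stE , tpE , csE) =
        suc T , h , Data.Sum.map (λ x → x) (λ x → trans x (cong st (sym (trun-+ t1 (suc t2) Y)))) stE ,
        (λ p → trans (tpE p) (cong (λ c → glue bx sh (tp (trun Tx (tstep X))) (tp c) p) (sym (trun-+ t1 (suc t2) Y)))) ,
        λ b lt → cong₂ _++_ (crossingAt-≡ b C X (proj₁ (proj₂ inv)) (proj₁ (proj₂ eqv)) (proj₁ eqv)) (csE b lt)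
        where
        eqv = ≈-trans (tstep-cong C _ inv) (step-glueˡ bx sh X (tp Y) hX)

      pasteʳ n C X Y Tx zero bnd (inv , ez , hX , hY) HX HY E =
        0 , subst (λ s → isHalting M s ≡ true) (sym (proj₁ inv)) HY , inj₂ (proj₁ inv) , tapeEq ,
        λ b lt → sym (noCrossing-right bx b Tx X E hX lt)
        where
        fr = noCrossing-frozen bx Tx X E
        tapeEq : ∀ p → tp C p ≡ glue bx sh (tp (trun Tx X)) (tp Y) p
        tapeEq p = trans (proj₂ (proj₂ inv) p)
          (glue-cong bx sh (λ p l → sym (proj₂ fr p (sides-<≮ l hX))) (λ _ _ → refl) p)
      pasteʳ zero C X Y Tx (suc Ty) bnd inv HX HY E = ⊥-elim (absurd bnd)
        where
        absurd : ¬ (Tx N.+ suc Ty N.≤ 0)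
        absurd h rewrite NP.+-suc Tx Ty with h
        ... | ()
      pasteʳ (suc n) C X Y Tx (suc Ty) bnd (inv , ez , hX , hY) HX HY E with crossingView by Y
      ... | noCross e s with step-glueʳ bx sh Y (tp X) (hd C) (R<' (λ h → hY (subst (_< by) ez h))) ez
      ... | (z' , eqv0 , ez') with pasteʳ n (tstep C) X (tstep Y) Tx Ty (budgetʳ Tx Ty n bnd) rinv HX HY E'
        where
        eqv = ≈-trans (tstep-cong C _ inv) eqv0
        nY' : ¬ hd (tstep Y) < by
        nY' = leftOf-false (trans s (≮⇒leftOf hY))
        rinv : RightInv (tstep C) X (tstep Y)
        rinv = (proj₁ eqv , refl , proj₂ (proj₂ eqv)) , trans (cong (_+ sh) (proj₁ (proj₂ eqv))) ez' , hX , nY'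
        E' = trans E (cong (_++ crossingSeq by (tstep Y) Ty) e)
      ... | (T , h , stE , tpE , csE) = suc T , h , stE , tpE ,
        λ b lt → trans (cong (_++ crossingSeq b (tstep C) T) (crossingAt-≮ b C (≮-mono lt nC) (≮-mono lt nC'))) (csE b lt)
        where
        eqv = ≈-trans (tstep-cong C _ inv) eqv0
        nC : ¬ hd C < bx
        nC = R<' (λ h → hY (subst (_< by) ez h))
        nC' : ¬ hd (tstep C) < bx
        nC' = R<' (λ h → leftOf-false (trans s (≮⇒leftOf hY)) (subst (_< by) (trans (cong (_+ sh) (proj₁ (proj₂ eqv))) ez') h))
      pasteʳ (suc n) C X Y Tx (suc Ty) bnd (inv , ez , hX , hY) HX HY E | cross e s
        with firstCrossing bx Tx X (st (tstep Y)) (crossingSeq by (tstep Y) Ty) (trans E (cong (_++ crossingSeq by (tstep Y) Ty) e))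
      ... | (t1 , t2 , refl , c1 , tk1 , c2) with crossingView bx (trun t1 X)
      ... | noCross e' _ with trans (sym e') tk1
      ... | ()
      pasteʳ (suc n) C X Y Tx (suc Ty) bnd (inv , ez , hX , hY) HX HY E | cross e s | (t1 , t2 , refl , c1 , tk1 , c2) | cross e' s'
        with step-glueʳ bx sh Y (tp X) (hd C) (R<' (λ h → hY (subst (_< by) ez h))) ez
      ... | (z' , eqv0 , ez')
        with pasteˡ n (tstep C) (tstep (trun t1 X)) (tstep Y) t2 Ty (budgetˡʳ t1 t2 Ty n bnd)
               (handoverʳ {C} {X} {Y} {z'} t1 hX hY (≈-trans (tstep-cong C _ inv) eqv0) (re-entry {z'} {Y} hY ez' s) s c1 (∷-injectiveˡ (trans (sym e') tk1)) s')
               (subst Halted (trun-+ t1 (suc t2) X) HX) HY c2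
      ... | (T , h , stE , tpE , csE) =
        suc T , h , Data.Sum.map (λ x → trans x (cong st (sym (trun-+ t1 (suc t2) X)))) (λ x → x) stE ,
        (λ p → trans (tpE p) (cong (λ c → glue bx sh (tp c) (tp (trun Ty (tstep Y))) p) (sym (trun-+ t1 (suc t2) X)))) ,
        λ b lt → trans (cong (_++ crossingSeq b (tstep C) T) (crossingAt-≮ b C (≮-mono lt nC) (suc≡⇒≮ back lt)))
                 (trans (csE b lt) (sym (rightExcursion-crossingSeq bx b t1 t2 X hX c1 s' lt)))
        where
        nC : ¬ hd C < bx
        nC = R<' (λ h → hY (subst (_< by) ez h))
        back : sucZ (hd (tstep C)) ≡ bx
        back = re-entry {hd (tstep C)} {Y} hY (trans (cong (_+ sh) (proj₁ (proj₂ (≈-trans (tstep-cong C _ inv) eqv0)))) ez') s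

    crossingPoint : ∀ {z z'} → Near z z' → ℤ
    crossingPoint {z} (inj₁ _) = z
    crossingPoint {z} (inj₂ (inj₁ _)) = sucZ z
    crossingPoint {z} (inj₂ (inj₂ _)) = z

    crossingAt-point : ∀ b c (nr : Near (hd c) (hd (tstep c))) → ¬ crossingAt b c ≡ [] → b ≡ crossingPoint nr
    crossingAt-point b c nr ne with crossingView b c
    ... | noCross e _ = ⊥-elim (ne e)
    ... | cross e s with nr
    ... | inj₁ eq = ⊥-elim (s (cong (leftOf b) eq))
    ... | inj₂ (inj₁ eq) = caseR (hd c <? b)
      where
      caseR : Dec (hd c < b) → b ≡ sucZ (hd c)
      caseR (yes l) = sym (trans (sym eq) (near-<-≮⇒≡ (inj₂ (inj₁ eq)) l (sides-< s l)))
      caseR (no n) = ⊥-elim (n (ZP.<-trans (i<suc[i] (hd c)) (subst (_< b) eq (sides-≮ s n))))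
    ... | inj₂ (inj₂ eq) = caseL (hd c <? b)
      where
      caseL : Dec (hd c < b) → b ≡ hd c
      caseL (yes l) = ⊥-elim (sides-< s l (subst (_< b) (sym eq) (ZP.<-trans (pred[i]<i (hd c)) l)))
      caseL (no n) = sym (trans (sym (ZP.suc-pred (hd c))) (trans (cong sucZ (sym eq)) (near-≮-<⇒suc≡ (inj₂ (inj₂ eq)) n (sides-≮ s n))))

    crossingAt-length : ∀ b c → length (crossingAt b c) N.≤ 1
    crossingAt-length b c with crossingView b c
    ... | noCross e _ rewrite e = N.z≤n
    ... | cross e _ rewrite e = N.s≤s N.z≤n

    sumBelow-crossingAt : ∀ c N → sumBelow (λ i → length (crossingAt (+ suc i) c)) N N.≤ 1
    sumBelow-crossingAt c N = sumBelow-≤1 _ N (λ i → crossingAt-length (+ suc i) c) u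
      where
      nz : ∀ i → ¬ length (crossingAt (+ suc i) c) ≡ 0 → ¬ crossingAt (+ suc i) c ≡ []
      nz i h e = h (cong length e)
      u : ∀ i j → ¬ length (crossingAt (+ suc i) c) ≡ 0 → ¬ length (crossingAt (+ suc j) c) ≡ 0 → i ≡ j
      u i j hi hj = NP.suc-injective (ZP.+-injective (trans (crossingAt-point _ c (tstep-near c) (nz i hi)) (sym (crossingAt-point _ c (tstep-near c) (nz j hj)))))

    sumBelow-crossingSeq : ∀ t c N → sumBelow (λ i → length (crossingSeq (+ suc i) c t)) N N.≤ t
    sumBelow-crossingSeq zero c N = NP.≤-reflexive (sumBelow-zero _ N (λ _ _ → refl))
    sumBelow-crossingSeq (suc t) c N = subst (N._≤ suc t) (sym (trans (sumBelow-cong _ _ N (λ i → length-++ (crossingAt (+ suc i) c)))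
                            (sumBelow-+ (λ i → length (crossingAt (+ suc i) c)) (λ i → length (crossingSeq (+ suc i) (tstep c) t)) N)))
                          (NP.+-mono-≤ (sumBelow-crossingAt c N) (sumBelow-crossingSeq t (tstep c) N))


open TapeMachine

module ZipperSimulation where

  open import Defs
  open IntegerSteps
  open TapeMachine
  open import Data.Nat as N using (ℕ; zero; suc)
  import Data.Nat.Properties as NP
  open import Data.Integer as Z using (ℤ; _+_; _-_; +_; -[1+_]; +0; 1ℤ; -1ℤ)
  open import Data.Integer.Properties as ZP using (_≟_)
  open import Data.Integer.Tactic.RingSolver using (solve-∀)
  open import Data.List using (List; []; _∷_)
  open import Data.Bool using (true; false)
  open import Data.Product using (Σ; _,_)
  open import Data.Empty using (⊥-elim)
  open import Relation.Nullary using (¬_; yes; no)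
  open import Relation.Binary.PropositionalEquality

  module Zipper {k m a q : ℕ} (M : TM k m a q) where
    open IntegerTape M
    open TM M

    cellAt : List S → ℕ → S
    cellAt [] _ = blank
    cellAt (x ∷ xs) zero = x
    cellAt (x ∷ xs) (suc n) = cellAt xs n

    headCell : List S → S
    headCell xs = cellAt xs 0

    tailCells : List S → List S
    tailCells [] = []
    tailCells (x ∷ xs) = xs

    relTape : List S → S → List S → ℤ → S
    relTape l h r (+ zero) = h
    relTape l h r (+ (suc n)) = cellAt r n
    relTape l h r -[1+ n ] = cellAt l n

    zipperTape : List S → S → List S → ℤ → Tape
    zipperTape l h r z p = relTape l h r (p - z)

    place : Config k m a q → ℤ → TapeConfig
    place (cfg p l h r) z = pc p (zipperTape l h r z) z

    relTape-right : ∀ l s r i → relTape (s ∷ l) (headCell r) (tailCells r) (predZ i) ≡ relTape l s r i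
    relTape-right l s r (+ zero) = refl
    relTape-right l s [] (+ suc zero) = refl
    relTape-right l s (x ∷ r) (+ suc zero) = refl
    relTape-right l s [] (+ suc (suc n)) = refl
    relTape-right l s (x ∷ r) (+ suc (suc n)) = refl
    relTape-right l s r -[1+ n ] = refl

    relTape-left : ∀ l s r i → relTape (tailCells l) (headCell l) (s ∷ r) (sucZ i) ≡ relTape l s r i
    relTape-left l s r (+ zero) = refl
    relTape-left l s r (+ suc n) = refl
    relTape-left [] s r -[1+ zero ] = refl
    relTape-left (x ∷ l) s r -[1+ zero ] = refl
    relTape-left [] s r -[1+ suc n ] = refl
    relTape-left (x ∷ l) s r -[1+ suc n ] = refl

    z-z : ∀ z → z - z ≡ +0
    z-z z = ZP.+-inverseʳ z

    relTape-off-head : ∀ l h h' r i → ¬ i ≡ +0 → relTape l h r i ≡ relTape l h' r i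
    relTape-off-head l h h' r (+ zero) n = ⊥-elim (n refl)
    relTape-off-head l h h' r (+ suc x) n = refl
    relTape-off-head l h h' r -[1+ x ] n = refl

    write-zipperTape : ∀ l h r z s p → write (zipperTape l h r z) z s p ≡ relTape l s r (p - z)
    write-zipperTape l h r z s p with p ≟ z
    ... | yes refl = sym (cong (relTape l s r) (z-z z))
    ... | no n = relTape-off-head l h s r (p - z) (λ e → n (sym (trans (sym (ZP.+-identityʳ z))
                     (trans (cong (λ w → z + w) (sym e)) (l1 z p)))))
      where
      l1 : ∀ z p → z + (p - z) ≡ p
      l1 = solve-∀

    ps : ∀ p z → p - sucZ z ≡ predZ (p - z)
    ps p z = l p z
      where
      l : ∀ p z → p - (1ℤ + z) ≡ -1ℤ + (p - z)
      l = solve-∀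

    pp : ∀ p z → p - predZ z ≡ sucZ (p - z)
    pp p z = l p z
      where
      l : ∀ p z → p - (-1ℤ + z) ≡ 1ℤ + (p - z)
      l = solve-∀

    rightCase : ∀ p' l h s r z → place (moveHead p' l s r right) (sucZ z) ≈ pc p' (write (zipperTape l h r z) z s) (sucZ z)
    rightCase p' l h s [] z = refl , refl , λ p0 →
      trans (cong (relTape (s ∷ l) blank []) (ps p0 z)) (trans (relTape-right l s [] (p0 - z)) (sym (write-zipperTape l h [] z s p0)))
    rightCase p' l h s (x ∷ r) z = refl , refl , λ p0 →
      trans (cong (relTape (s ∷ l) x r) (ps p0 z)) (trans (relTape-right l s (x ∷ r) (p0 - z)) (sym (write-zipperTape l h (x ∷ r) z s p0)))

    leftCase : ∀ p' l h s r z → place (moveHead p' l s r left) (predZ z) ≈ pc p' (write (zipperTape l h r z) z s) (predZ z)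
    leftCase p' [] h s r z = refl , refl , λ p0 →
      trans (cong (relTape [] blank (s ∷ r)) (pp p0 z)) (trans (relTape-left [] s r (p0 - z)) (sym (write-zipperTape [] h r z s p0)))
    leftCase p' (x ∷ l) h s r z = refl , refl , λ p0 →
      trans (cong (relTape l x (s ∷ r)) (pp p0 z)) (trans (relTape-left (x ∷ l) s r (p0 - z)) (sym (write-zipperTape (x ∷ l) h r z s p0)))

    step-place : ∀ c z → Σ ℤ λ z' → place (step M c) z' ≈ tstep (place c z)
    step-place (cfg p l h r) z with isHalting M p
    ... | true = z , ≈-refl
    ... | false rewrite cong (relTape l h r) (z-z z) with δ p h
    ... | (p' , s , stay) = z , refl , refl , λ p0 → sym (write-zipperTape l h r z s p0)
    ... | (p' , s , right) = sucZ z , rightCase p' l h s r z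
    ... | (p' , s , left) = predZ z , leftCase p' l h s r z

    run-place : ∀ t c z → Σ ℤ λ z' → place (run M t c) z' ≈ trun t (place c z)
    run-place zero c z = z , ≈-refl
    run-place (suc t) c z with step-place c z
    ... | (z1 , e1) with run-place t (step M c) z1
    ... | (z2 , e2) = z2 , ≈-trans e2 (trun-cong t _ _ e1)


open ZipperSimulation

module TapeContent where

  open import Defs
  open IntegerSteps
  open TapeMachine
  open ZipperSimulation
  open import Data.Nat as N using (ℕ; zero; suc)
  import Data.Nat.Properties as NP
  open import Data.Integer as Z using (ℤ; _+_; _-_; _<_; _≤_; +_; -[1+_]; +0; 1ℤ; -1ℤ)
  import Data.Integer.Properties as ZP
  open import Data.Integer.Tactic.RingSolver using (solve-∀)
  open import Data.Fin using (Fin)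
  open import Data.List using (List; []; _∷_; _++_; reverse; length)
  open import Data.List.Properties using (++-assoc; ++-identityʳ; unfold-reverse; length-++)
  open import Data.Product using (Σ; _×_; _,_; proj₁; proj₂)
  open import Relation.Nullary using (¬_)
  open import Relation.Binary.PropositionalEquality

  module Content {k m a q : ℕ} (M : TM k m a q) where
    open IntegerTape M
    open Zipper M

    outputOf : S → List (Fin m)
    outputOf (outp g) = g ∷ []
    outputOf blank = []
    outputOf lend = []
    outputOf rend = []
    outputOf (inp _) = []
    outputOf (aux _) = []

    outputs-cons : ∀ x xs → outputs (x ∷ xs) ≡ outputOf x ++ outputs xs
    outputs-cons blank xs = refl
    outputs-cons lend xs = refl
    outputs-cons rend xs = refl
    outputs-cons (inp x) xs = refl
    outputs-cons (outp x) xs = refl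
    outputs-cons (aux x) xs = refl

    outputs-++ : ∀ (xs ys : List S) → outputs (xs ++ ys) ≡ outputs xs ++ outputs ys
    outputs-++ [] ys = refl
    outputs-++ (x ∷ xs) ys = trans (outputs-cons x (xs ++ ys))
      (trans (cong (outputOf x ++_) (outputs-++ xs ys)) (trans (sym (++-assoc (outputOf x) _ _)) (cong (_++ outputs ys) (sym (outputs-cons x xs)))))

    outputsR : Tape → ℤ → ℕ → List (Fin m)
    outputsR T b zero = []
    outputsR T b (suc n) = outputOf (T b) ++ outputsR T (sucZ b) n

    outputsL : Tape → ℤ → ℕ → List (Fin m)
    outputsL T b zero = []
    outputsL T b (suc n) = outputsL T (predZ b) n ++ outputOf (T (predZ b))

    BlankFrom BlankBefore : Tape → ℤ → Set
    BlankFrom T b = ∀ j → T (b + + j) ≡ blank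
    BlankBefore T b = ∀ j → T (b + -[1+ j ]) ≡ blank

    RightContent LeftContent : Tape → ℤ → List (Fin m) → Set
    RightContent T b U = Σ ℕ λ n → BlankFrom T (b + + n) × outputsR T b n ≡ U
    LeftContent T b U = Σ ℕ λ n → BlankBefore T (b - + n) × outputsL T b n ≡ U

    SplitContent : Tape → ℤ → List (Fin m) → List (Fin m) → Set
    SplitContent T b U1 U2 = LeftContent T b U1 × RightContent T b U2

    suc-+-shift : ∀ b j → (1ℤ + b) + + j ≡ b + (1ℤ + + j)
    suc-+-shift b j = l b (+ j) where
      l : ∀ (b J : ℤ) → (1ℤ + b) + J ≡ b + (1ℤ + J)
      l = solve-∀
    shiftˡ-suc : ∀ b n j → ((1ℤ + b) + Z.- (1ℤ + + n)) + Z.- (1ℤ + + j) ≡ (b + Z.- (+ n)) + Z.- (1ℤ + + j)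
    shiftˡ-suc b n j = l b (+ n) (+ j) where
      l : ∀ (b N J : ℤ) → ((1ℤ + b) + Z.- (1ℤ + N)) + Z.- (1ℤ + J) ≡ (b + Z.- N) + Z.- (1ℤ + J)
      l = solve-∀
    shiftˡ-cancel : ∀ (b : ℤ) → ((1ℤ + b) + Z.- (+ 0)) + Z.- (1ℤ + + 0) ≡ b
    shiftˡ-cancel b = l b where
      l : ∀ (b : ℤ) → ((1ℤ + b) + Z.- (+ 0)) + Z.- (1ℤ + + 0) ≡ b
      l = solve-∀
    shiftˡ-suc′ : ∀ b j → (b + Z.- (+ 0)) + Z.- (1ℤ + + j) ≡ ((1ℤ + b) + Z.- (+ 0)) + Z.- (1ℤ + (1ℤ + + j))
    shiftˡ-suc′ b j = l b (+ j) where
      l : ∀ (b J : ℤ) → (b + Z.- (+ 0)) + Z.- (1ℤ + J) ≡ ((1ℤ + b) + Z.- (+ 0)) + Z.- (1ℤ + (1ℤ + J))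
      l = solve-∀
    shiftˡ-suc⁻¹ : ∀ b n j → (b + Z.- (+ n)) + Z.- (1ℤ + + j) ≡ ((1ℤ + b) + Z.- (1ℤ + + n)) + Z.- (1ℤ + + j)
    shiftˡ-suc⁻¹ b n j = sym (shiftˡ-suc b n j)
    shiftʳ-zero : ∀ b → (b + + 0) + + 0 ≡ b
    shiftʳ-zero b = l b where
      l : ∀ (b : ℤ) → (b + + 0) + + 0 ≡ b
      l = solve-∀
    shiftʳ-suc : ∀ b j → ((1ℤ + b) + + 0) + + j ≡ (b + + 0) + (1ℤ + + j)
    shiftʳ-suc b j = l b (+ j) where
      l : ∀ (b J : ℤ) → ((1ℤ + b) + + 0) + J ≡ (b + + 0) + (1ℤ + J)
      l = solve-∀
    shiftʳ-suc′ : ∀ b n j → ((1ℤ + b) + + n) + + j ≡ (b + (1ℤ + + n)) + + j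
    shiftʳ-suc′ b n j = l b (+ n) (+ j) where
      l : ∀ (b N J : ℤ) → ((1ℤ + b) + N) + J ≡ (b + (1ℤ + N)) + J
      l = solve-∀

    left-extend : ∀ T b U → LeftContent T b U → LeftContent T (sucZ b) (U ++ outputOf (T b))
    left-extend T b U (n , bl , e) = suc n , (λ j → subst (λ p → T p ≡ blank) (sym (shiftˡ-suc b n j)) (bl j)) ,
      subst (λ p → outputsL T p n ++ outputOf (T p) ≡ U ++ outputOf (T b)) (sym (ZP.pred-suc b)) (cong (_++ outputOf (T b)) e)

    left-shrink : ∀ T b V → LeftContent T (sucZ b) V → Σ _ λ U → LeftContent T b U × V ≡ U ++ outputOf (T b)
    left-shrink T b V (zero , bl , e) = [] , (0 , (λ j → subst (λ p → T p ≡ blank) (sym (shiftˡ-suc′ b j)) (bl (suc j))) , refl) ,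
      trans (sym e) (cong outputOf (sym (subst (λ p → T p ≡ blank) (shiftˡ-cancel b) (bl 0))))
    left-shrink T b V (suc n , bl , e) = outputsL T b n , (n , (λ j → subst (λ p → T p ≡ blank) (sym (shiftˡ-suc⁻¹ b n j)) (bl j)) , refl) ,
      trans (sym e) (cong (λ p → outputsL T p n ++ outputOf (T p)) (ZP.pred-suc b))

    right-shrink : ∀ T b U → RightContent T b U → Σ _ λ U' → RightContent T (sucZ b) U' × U ≡ outputOf (T b) ++ U'
    right-shrink T b U (zero , bl , e) = [] , (0 , (λ j → subst (λ p → T p ≡ blank) (sym (shiftʳ-suc b j)) (bl (suc j))) , refl) ,
      trans (sym e) (cong (λ s → outputOf s ++ []) (sym (subst (λ p → T p ≡ blank) (shiftʳ-zero b) (bl 0))))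
    right-shrink T b U (suc n , bl , e) = outputsR T (sucZ b) n , (n , (λ j → subst (λ p → T p ≡ blank) (sym (shiftʳ-suc′ b n j)) (bl j)) , refl) , sym e

    right-extend : ∀ T b U → RightContent T (sucZ b) U → RightContent T b (outputOf (T b) ++ U)
    right-extend T b U (n , bl , e) = suc n , (λ j → subst (λ p → T p ≡ blank) (shiftʳ-suc′ b n j) (bl j)) , cong (outputOf (T b) ++_) e

    split-right : ∀ T b U1 U2 → SplitContent T b U1 U2 → Σ _ λ V1 → Σ _ λ V2 → SplitContent T (sucZ b) V1 V2 × U1 ++ U2 ≡ V1 ++ V2
    split-right T b U1 U2 (lo , ro) with right-shrink T b U2 ro
    ... | (U2' , ro' , e) = U1 ++ outputOf (T b) , U2' , (left-extend T b U1 lo , ro') ,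
          trans (cong (U1 ++_) e) (sym (++-assoc U1 (outputOf (T b)) U2'))

    split-left : ∀ T b U1 U2 → SplitContent T (sucZ b) U1 U2 → Σ _ λ V1 → Σ _ λ V2 → SplitContent T b V1 V2 × U1 ++ U2 ≡ V1 ++ V2
    split-left T b U1 U2 (lo , ro) with left-shrink T b U1 lo
    ... | (V1 , lo' , e) = V1 , outputOf (T b) ++ U2 , (lo' , right-extend T b U2 ro) ,
          trans (cong (_++ U2) e) (++-assoc V1 (outputOf (T b)) U2)

    split-right-by : ∀ T b U1 U2 d → SplitContent T b U1 U2 → Σ _ λ V1 → Σ _ λ V2 → SplitContent T (b + + d) V1 V2 × U1 ++ U2 ≡ V1 ++ V2
    split-right-by T b U1 U2 zero o = U1 , U2 , subst (λ p → SplitContent T p U1 U2) (sym (ZP.+-identityʳ b)) o , refl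
    split-right-by T b U1 U2 (suc d) o with split-right-by T b U1 U2 d o
    ... | (V1 , V2 , o' , eq) with split-right T (b + + d) V1 V2 o'
    ... | (W1 , W2 , o'' , eq') = W1 , W2 , subst (λ p → SplitContent T p W1 W2) (ee b d) o'' , trans eq eq'
      where
      ee : ∀ b d → (1ℤ + (b + + d)) ≡ b + (1ℤ + + d)
      ee b d = l b (+ d) where
        l : ∀ (b D : ℤ) → (1ℤ + (b + D)) ≡ b + (1ℤ + D)
        l = solve-∀

    shiftˡ-one : ∀ (b : ℤ) → b ≡ 1ℤ + (b + -[1+ 0 ])
    shiftˡ-one b = sym (l b) where
      l : ∀ (b : ℤ) → 1ℤ + (b + Z.- (1ℤ + + 0)) ≡ b
      l = solve-∀

    shiftˡ-step : ∀ b d → b + -[1+ d ] ≡ 1ℤ + (b + -[1+ suc d ])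
    shiftˡ-step b d = l b (+ d) where
      l : ∀ (b D : ℤ) → b + Z.- (1ℤ + D) ≡ 1ℤ + (b + Z.- (1ℤ + (1ℤ + D)))
      l = solve-∀

    split-left-by : ∀ T b U1 U2 d → SplitContent T b U1 U2 → Σ _ λ V1 → Σ _ λ V2 → SplitContent T (b + -[1+ d ]) V1 V2 × U1 ++ U2 ≡ V1 ++ V2
    split-left-by T b U1 U2 zero o = split-left T (b + -[1+ 0 ]) U1 U2 (subst (λ p → SplitContent T p U1 U2) (shiftˡ-one b) o)
    split-left-by T b U1 U2 (suc d) o = stp (split-left-by T b U1 U2 d o)
      where
      stp : (Σ _ λ V1 → Σ _ λ V2 → SplitContent T (b + -[1+ d ]) V1 V2 × U1 ++ U2 ≡ V1 ++ V2) →
             Σ _ λ V1 → Σ _ λ V2 → SplitContent T (b + -[1+ suc d ]) V1 V2 × U1 ++ U2 ≡ V1 ++ V2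
      stp (V1 , V2 , o' , eq) = step2 (split-left T (b + -[1+ suc d ]) V1 V2 (subst (λ p → SplitContent T p V1 V2) (shiftˡ-step b d) o'))
        where
        step2 : (Σ _ λ W1 → Σ _ λ W2 → SplitContent T (b + -[1+ suc d ]) W1 W2 × V1 ++ V2 ≡ W1 ++ W2) →
                Σ _ λ W1 → Σ _ λ W2 → SplitContent T (b + -[1+ suc d ]) W1 W2 × U1 ++ U2 ≡ W1 ++ W2
        step2 (W1 , W2 , o'' , eq') = W1 , W2 , o'' , trans eq eq'

    split-anywhere : ∀ T b U1 U2 b' → SplitContent T b U1 U2 → Σ _ λ V1 → Σ _ λ V2 → SplitContent T b' V1 V2 × U1 ++ U2 ≡ V1 ++ V2
    split-anywhere T b U1 U2 b' o = go (b' - b) refl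
      where
      ee : ∀ (b b' : ℤ) → b + (b' - b) ≡ b'
      ee = solve-∀
      go : ∀ x → b' - b ≡ x → Σ _ λ V1 → Σ _ λ V2 → SplitContent T b' V1 V2 × U1 ++ U2 ≡ V1 ++ V2
      go (+ d) e with split-right-by T b U1 U2 d o
      ... | (V1 , V2 , o' , eq) = V1 , V2 , subst (λ p → SplitContent T p V1 V2) (trans (cong (λ w → b + w) (sym e)) (ee b b')) o' , eq
      go -[1+ d ] e with split-left-by T b U1 U2 d o
      ... | (V1 , V2 , o' , eq) = V1 , V2 , subst (λ p → SplitContent T p V1 V2) (trans (cong (λ w → b + w) (sym e)) (ee b b')) o' , eq

    blankFrom-outputs : ∀ T b j → BlankFrom T b → outputsR T b j ≡ []
    blankFrom-outputs T b zero bl = refl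
    blankFrom-outputs T b (suc j) bl = cong₂ _++_ (cong outputOf (subst (λ p → T p ≡ blank) (ZP.+-identityʳ b) (bl 0)))
      (blankFrom-outputs T (sucZ b) j (λ i → subst (λ p → T p ≡ blank) (sym (suc-+-shift b i)) (bl (suc i))))

    outputsR-stable : ∀ T b n j → BlankFrom T (b + + n) → outputsR T b (n N.+ j) ≡ outputsR T b n
    outputsR-stable T b zero j bl = blankFrom-outputs T b j (λ i → subst (λ p → T p ≡ blank) (cong (_+ + i) (ZP.+-identityʳ b)) (bl i))
    outputsR-stable T b (suc n) j bl = cong (outputOf (T b) ++_) (outputsR-stable T (sucZ b) n j (λ i → subst (λ p → T p ≡ blank) (sym (shiftʳ-suc′ b n i)) (bl i)))

    blankBefore-outputs : ∀ T b j → BlankBefore T b → outputsL T b j ≡ []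
    blankBefore-outputs T b zero bl = refl
    blankBefore-outputs T b (suc j) bl = cong₂ _++_
      (blankBefore-outputs T (predZ b) j (λ i → subst (λ p → T p ≡ blank) (ee1 b i) (bl (suc i))))
      (cong outputOf (subst (λ p → T p ≡ blank) (ee2 b) (bl 0)))
      where
      ee1 : ∀ b i → b + Z.- (1ℤ + (1ℤ + + i)) ≡ (-1ℤ + b) + Z.- (1ℤ + + i)
      ee1 b i = l b (+ i) where
        l : ∀ (b I : ℤ) → b + Z.- (1ℤ + (1ℤ + I)) ≡ (-1ℤ + b) + Z.- (1ℤ + I)
        l = solve-∀
      ee2 : ∀ (b : ℤ) → b + Z.- (1ℤ + + 0) ≡ -1ℤ + b
      ee2 = solve-∀

    outputsL-stable : ∀ T b n j → BlankBefore T (b - + n) → outputsL T b (n N.+ j) ≡ outputsL T b n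
    outputsL-stable T b zero j bl = blankBefore-outputs T b j (λ i → subst (λ p → T p ≡ blank) (ee b i) (bl i))
      where
      ee : ∀ b i → (b + Z.- (+ 0)) + Z.- (1ℤ + + i) ≡ b + Z.- (1ℤ + + i)
      ee b i = l b (+ i) where
        l : ∀ (b I : ℤ) → (b + Z.- (+ 0)) + Z.- (1ℤ + I) ≡ b + Z.- (1ℤ + I)
        l = solve-∀
    outputsL-stable T b (suc n) j bl = cong (_++ outputOf (T (predZ b))) (outputsL-stable T (predZ b) n j (λ i → subst (λ p → T p ≡ blank) (ee b n i) (bl i)))
      where
      ee : ∀ b n i → (b + Z.- (1ℤ + + n)) + Z.- (1ℤ + + i) ≡ ((-1ℤ + b) + Z.- (+ n)) + Z.- (1ℤ + + i)
      ee b n i = l b (+ n) (+ i) where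
        l : ∀ (b N I : ℤ) → (b + Z.- (1ℤ + N)) + Z.- (1ℤ + I) ≡ ((-1ℤ + b) + Z.- N) + Z.- (1ℤ + I)
        l = solve-∀

    rightContent-unique : ∀ T b U U' → RightContent T b U → RightContent T b U' → U ≡ U'
    rightContent-unique T b U U' (n , bl , e) (n' , bl' , e') =
      trans (sym e) (trans (sym (outputsR-stable T b n n' bl)) (trans (cong (outputsR T b) (NP.+-comm n n')) (trans (outputsR-stable T b n' n bl') e')))

    leftContent-unique : ∀ T b U U' → LeftContent T b U → LeftContent T b U' → U ≡ U'
    leftContent-unique T b U U' (n , bl , e) (n' , bl' , e') =
      trans (sym e) (trans (sym (outputsL-stable T b n n' bl)) (trans (cong (outputsL T b) (NP.+-comm n n')) (trans (outputsL-stable T b n' n bl') e')))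

    split-total : ∀ T b U1 U2 b' V1 V2 → SplitContent T b U1 U2 → SplitContent T b' V1 V2 → U1 ++ U2 ≡ V1 ++ V2
    split-total T b U1 U2 b' V1 V2 o o' with split-anywhere T b U1 U2 b' o
    ... | (W1 , W2 , (lo , ro) , eq) = trans eq (cong₂ _++_ (leftContent-unique T b' W1 V1 lo (proj₁ o')) (rightContent-unique T b' W2 V2 ro (proj₂ o')))


    cellAt-beyond : ∀ xs j → cellAt xs (length xs N.+ j) ≡ blank
    cellAt-beyond [] j = refl
    cellAt-beyond (x ∷ xs) j = cellAt-beyond xs j

    outputsR-window : ∀ T b xs → (∀ j → T (b + + j) ≡ cellAt xs j) → outputsR T b (length xs) ≡ outputs xs
    outputsR-window T b [] h = refl
    outputsR-window T b (x ∷ xs) h = trans (cong₂ _++_ (cong outputOf (trans (cong T (sym (ZP.+-identityʳ b))) (h 0)))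
        (outputsR-window T (sucZ b) xs (λ j → trans (cong T (suc-+-shift b j)) (h (suc j))))) (sym (outputs-cons x xs))

    outputsL-window : ∀ T b xs → (∀ j → T (b + -[1+ j ]) ≡ cellAt xs j) → outputsL T b (length xs) ≡ outputs (reverse xs)
    outputsL-window T b [] h = refl
    outputsL-window T b (x ∷ xs) h = trans (cong₂ _++_
        (outputsL-window T (predZ b) xs (λ j → trans (cong T (ee1 b j)) (h (suc j))))
        (cong outputOf (trans (cong T (ee2 b)) (h 0))))
        (sym (trans (cong outputs (unfold-reverse x xs)) (trans (outputs-++ (reverse xs) (x ∷ []))
             (cong (outputs (reverse xs) ++_) (trans (outputs-cons x []) (++-identityʳ (outputOf x)))))))
      where
      ee1 : ∀ b j → (-1ℤ + b) + -[1+ j ] ≡ b + -[1+ suc j ]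
      ee1 b j = l b (+ j) where
        l : ∀ (b J : ℤ) → (-1ℤ + b) + Z.- (1ℤ + J) ≡ b + Z.- (1ℤ + (1ℤ + J))
        l = solve-∀
      ee2 : ∀ (b : ℤ) → -1ℤ + b ≡ b + -[1+ 0 ]
      ee2 = solve-∀

    relz : ∀ (z J : ℤ) → (z + J) - z ≡ J
    relz = solve-∀

    zipper-split : ∀ l h r z → SplitContent (zipperTape l h r z) z (outputs (reverse l)) (outputs (h ∷ r))
    zipper-split l h r z = (length l , bl , outputsL-window (zipperTape l h r z) z l wl) , (suc (length r) , br , outputsR-window (zipperTape l h r z) z (h ∷ r) wr)
      where
      wr : ∀ j → zipperTape l h r z (z + + j) ≡ cellAt (h ∷ r) j
      wr j rewrite relz z (+ j) with j
      ... | zero = refl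
      ... | suc j' = refl
      wl : ∀ j → zipperTape l h r z (z + -[1+ j ]) ≡ cellAt l j
      wl j rewrite relz z -[1+ j ] = refl
      br : BlankFrom (zipperTape l h r z) (z + + suc (length r))
      br j = trans (cong (relTape l h r) (ee z (+ suc (length r)) (+ j))) (cellAt-beyond r j)
        where
        ee : ∀ (z X J : ℤ) → ((z + X) + J) - z ≡ X + J
        ee = solve-∀
      bl : BlankBefore (zipperTape l h r z) (z - + length l)
      bl j = trans (cong (relTape l h r) (ee z (+ length l) (+ j))) (cellAt-beyond l j)
        where
        ee : ∀ (z X J : ℤ) → ((z + Z.- X) + Z.- (1ℤ + J)) - z ≡ Z.- (1ℤ + (X + J))
        ee = solve-∀

    content-split : ∀ p l h r → content (cfg {k} {m} {a} {q} p l h r) ≡ outputs (reverse l) ++ outputs (h ∷ r)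
    content-split p l h r = outputs-++ (reverse l) (h ∷ r)


    b+neg<b : ∀ b x → b + -[1+ x ] < b
    b+neg<b b x = subst (b + -[1+ x ] <_) (ZP.+-identityʳ b) (ZP.+-monoʳ-< b Z.-<+)

    outputsL-cong : ∀ T T' b n → (∀ p → p < b → T p ≡ T' p) → outputsL T b n ≡ outputsL T' b n
    outputsL-cong T T' b zero h = refl
    outputsL-cong T T' b (suc n) h = cong₂ _++_ (outputsL-cong T T' (predZ b) n (λ p l → h p (ZP.<-trans l (pred[i]<i b))))
      (cong outputOf (h (predZ b) (pred[i]<i b)))

    leftContent-transfer : ∀ T T' b U → (∀ p → p < b → T p ≡ T' p) → LeftContent T b U → LeftContent T' b U
    leftContent-transfer T T' b U h (n , bl , e) = n , (λ j → trans (sym (h _ (lt j))) (bl j)) , trans (sym (outputsL-cong T T' b n h)) e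
      where
      lt : ∀ j → (b - + n) + -[1+ j ] < b
      lt j = subst (_< b) (sym (ee b (+ n) (+ j))) (b+neg<b b (n N.+ j))
        where
        ee : ∀ (b N J : ℤ) → (b + Z.- N) + Z.- (1ℤ + J) ≡ b + Z.- (1ℤ + (N + J))
        ee = solve-∀

    outputsR-shift : ∀ T T' b b' n → (∀ j → j N.< n → T (b + + j) ≡ T' (b' + + j)) → outputsR T b n ≡ outputsR T' b' n
    outputsR-shift T T' b b' zero h = refl
    outputsR-shift T T' b b' (suc n) h = cong₂ _++_
      (cong outputOf (trans (cong T (sym (ZP.+-identityʳ b))) (trans (h 0 (N.s≤s N.z≤n)) (cong T' (ZP.+-identityʳ b')))))
      (outputsR-shift T T' (sucZ b) (sucZ b') n (λ j l → trans (cong T (suc-+-shift b j)) (trans (h (suc j) (N.s≤s l)) (cong T' (sym (suc-+-shift b' j))))))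

    ≮b+j : ∀ b j → ¬ (b + + j) < b
    ≮b+j b j l = ZP.<⇒≱ l (ZP.i≤i+j b (+ j))

    rightContent-shift : ∀ T T' b sh U → (∀ p → ¬ p < b → T p ≡ T' (p + sh)) → RightContent T' (b + sh) U → RightContent T b U
    rightContent-shift T T' b sh U h (n , bl , e) = n , bl' , trans (outputsR-shift T T' b (b + sh) n (λ j _ → trans (h _ (≮b+j b j)) (cong T' (ee1 b (+ j) sh)))) e
      where
      ee1 : ∀ (b J sh : ℤ) → (b + J) + sh ≡ (b + sh) + J
      ee1 = solve-∀
      ee2 : ∀ (b N J sh : ℤ) → ((b + N) + J) + sh ≡ ((b + sh) + N) + J
      ee2 = solve-∀
      ee3 : ∀ (b N J : ℤ) → (b + N) + J ≡ b + (N + J)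
      ee3 = solve-∀
      bl' : BlankFrom T (b + + n)
      bl' j = trans (h _ (λ l → ≮b+j b (n N.+ j) (subst (_< b) (ee3 b (+ n) (+ j)) l))) (trans (cong T' (ee2 b (+ n) (+ j) sh)) (bl j))

    rightContent-transfer : ∀ T T' b U → (∀ p → ¬ p < b → T p ≡ T' p) → RightContent T b U → RightContent T' b U
    rightContent-transfer T T' b U h ro = rightContent-shift T' T b +0 U (λ p n → trans (sym (h p n)) (cong T (sym (ZP.+-identityʳ p)))) (subst (λ x → RightContent T x U) (sym (ZP.+-identityʳ b)) ro)

    split-transfer : ∀ T T' b U1 U2 → (∀ p → T p ≡ T' p) → SplitContent T b U1 U2 → SplitContent T' b U1 U2
    split-transfer T T' b U1 U2 h (lo , ro) = leftContent-transfer T T' b U1 (λ p _ → h p) lo , rightContent-transfer T T' b U2 (λ p _ → h p) ro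

    outputsR-+ : ∀ T b n d → outputsR T b (n N.+ d) ≡ outputsR T b n ++ outputsR T (b + + n) d
    outputsR-+ T b zero d = cong (λ x → outputsR T x d) (sym (ZP.+-identityʳ b))
    outputsR-+ T b (suc n) d = trans (cong (outputOf (T b) ++_) (trans (outputsR-+ T (sucZ b) n d) (cong (λ x → outputsR T (sucZ b) n ++ outputsR T x d) (suc-+-shift b n))))
      (sym (++-assoc (outputOf (T b)) _ _))

    rightContent-prepend : ∀ T b d V U → outputsR T b d ≡ V → RightContent T (b + + d) U → RightContent T b (V ++ U)
    rightContent-prepend T b zero V U refl ro = subst (λ x → RightContent T x U) (ZP.+-identityʳ b) ro
    rightContent-prepend T b (suc d) V U refl ro =
      subst (RightContent T b) (sym (++-assoc (outputOf (T b)) _ U))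
        (right-extend T b _ (rightContent-prepend T (sucZ b) d _ U refl (subst (λ x → RightContent T x U) (sym (suc-+-shift b d)) ro)))

    outputsR-length : ∀ T b U → RightContent T b U → ∀ n → length (outputsR T b n) N.≤ length U
    outputsR-length T b U (n2 , bl , e) n = subst (λ x → length (outputsR T b n) N.≤ length x) eq
        (subst (λ x → length (outputsR T b n) N.≤ x) (sym (length-++ (outputsR T b n))) (NP.m≤m+n _ _))
      where
      eq : outputsR T b n ++ outputsR T (b + + n) n2 ≡ U
      eq = trans (sym (outputsR-+ T b n n2)) (trans (cong (outputsR T b) (NP.+-comm n n2)) (trans (outputsR-stable T b n2 n bl) e))


open TapeContent

module Pumping where

  open import Defs
  open IntegerSteps
  open TapeMachine
  open ZipperSimulation
  open TapeContent
  open import Data.Nat as N using (ℕ; zero; suc)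
  import Data.Nat.Properties as NP
  open import Data.Integer as Z using (ℤ; _+_; _-_; _<_; +_; -[1+_]; +0; 1ℤ; +<+; -<+)
  open import Data.Integer.Properties as ZP using (_<?_)
  open import Data.Integer.Tactic.RingSolver using (solve-∀)
  open import Data.Fin using (Fin) renaming (_≟_ to _≟F_)
  open import Data.List using (List; []; _∷_; _++_; reverse; length; map)
  open import Data.List.Properties using (++-assoc; length-++)
  open import Data.Maybe using (Maybe; just; nothing)
  open import Data.Bool using (true)
  open import Data.Product using (Σ; _×_; _,_; proj₁; proj₂)
  import Data.Sum
  open import Data.Empty using (⊥-elim)
  open import Relation.Nullary using (¬_; yes; no)
  open import Relation.Binary.PropositionalEquality

  power : ∀ {k} → Word k → ℕ → Word k
  power b zero = []
  power b (suc n) = b ++ power b n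

  pump : ∀ {k} → Word k → Word k → ℕ → Word k
  pump b c zero = c
  pump b c (suc n) = b ++ pump b c n

  pump≡power++ : ∀ {k} (b c : Word k) n → pump b c n ≡ power b n ++ c
  pump≡power++ b c zero = refl
  pump≡power++ b c (suc n) = trans (cong (b ++_) (pump≡power++ b c n)) (sym (++-assoc b (power b n) c))

  module Run {k m na q : ℕ} (M : TM k m na q) where
    open IntegerTape M
    open Zipper M
    open Content M

    R : List S
    R = rend ∷ []

    initial : Word k → TapeConfig
    initial w = place (initConfig M w) +0

    initialTape : Word k → ℤ → S
    initialTape w = relTape [] lend (map inp w ++ R)

    initial-tape : ∀ w p → tp (initial w) p ≡ initialTape w p
    initial-tape w p = cong (initialTape w) (ZP.+-identityʳ p)

    cellAt-prefix : ∀ (u v v' : Word k) t → t N.< length u → cellAt (map inp (u ++ v) ++ R) t ≡ cellAt (map inp (u ++ v') ++ R) t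
    cellAt-prefix (x ∷ u) v v' zero l = refl
    cellAt-prefix (x ∷ u) v v' (suc t) (N.s≤s l) = cellAt-prefix u v v' t l

    cellAt-suffix : ∀ (u v : Word k) t → cellAt (map inp (u ++ v) ++ R) (length u N.+ t) ≡ cellAt (map inp v ++ R) t
    cellAt-suffix [] v t = refl
    cellAt-suffix (x ∷ u) v t = cellAt-suffix u v t

    initial-glue : ∀ (u1 u2 r c' : Word k) p →
      tp (initial (u1 ++ u2 ++ r)) p ≡
      glue (+ suc (length u1 N.+ length u2)) (Z.- (+ length u2)) (tp (initial (u1 ++ u2 ++ c'))) (tp (initial (u1 ++ r))) p
    initial-glue u1 u2 r c' p with p <? + suc (length u1 N.+ length u2)
    ... | yes l = trans (initial-tape _ p) (trans (lft p l) (sym (initial-tape _ p)))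
      where
      lft : ∀ p → p < + suc (length u1 N.+ length u2) → initialTape (u1 ++ u2 ++ r) p ≡ initialTape (u1 ++ u2 ++ c') p
      lft -[1+ n ] _ = refl
      lft (+ zero) _ = refl
      lft (+ suc t) (+<+ (N.s≤s h)) =
        trans (cong (λ w → cellAt (map inp w ++ R) t) (sym (++-assoc u1 u2 r)))
          (trans (cellAt-prefix (u1 ++ u2) r c' t (subst (t N.<_) (sym (length-++ u1)) h))
            (cong (λ w → cellAt (map inp w ++ R) t) (++-assoc u1 u2 c')))
    ... | no n = trans (initial-tape _ p) (trans (rgt p n) (sym (initial-tape (u1 ++ r) (p + Z.- (+ length u2)))))
      where
      A = length u1
      B = length u2
      rgt : ∀ p → ¬ p < + suc (A N.+ B) → initialTape (u1 ++ u2 ++ r) p ≡ initialTape (u1 ++ r) (p + Z.- (+ B))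
      rgt -[1+ n ] h = ⊥-elim (h -<+)
      rgt (+ zero) h = ⊥-elim (h (+<+ (N.s≤s N.z≤n)))
      rgt (+ suc t) h = trans (cong (λ x → cellAt (map inp (u1 ++ u2 ++ r) ++ R) x) (sym e))
          (trans (cong (λ w → cellAt (map inp w ++ R) ((A N.+ B) N.+ u)) (sym (++-assoc u1 u2 r)))
          (trans (subst (λ L → cellAt (map inp ((u1 ++ u2) ++ r) ++ R) (L N.+ u) ≡ cellAt (map inp r ++ R) u) (length-++ u1) (cellAt-suffix (u1 ++ u2) r u))
          (trans (sym (cellAt-suffix u1 r u)) (cong (initialTape (u1 ++ r)) (sym pe)))))
        where
        le : A N.+ B N.≤ t
        le = NP.≤-pred (NP.≮⇒≥ (λ x → h (+<+ x)))
        u = t N.∸ (A N.+ B)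
        e : (A N.+ B) N.+ u ≡ t
        e = NP.m+[n∸m]≡n le
        pe : + suc t + Z.- (+ B) ≡ + suc (A N.+ u)
        pe = trans (cong (λ x → + suc x + Z.- (+ B)) (sym e)) (ring (+ A) (+ B) (+ u))
          where
          ring : ∀ (A B U : ℤ) → (1ℤ + ((A + B) + U)) + Z.- B ≡ 1ℤ + (A + U)
          ring = solve-∀

    accept-halts : isHalting M (TM.accept M) ≡ true
    accept-halts with TM.accept M ≟F TM.accept M | TM.accept M ≟F TM.reject M
    ... | yes _ | _ = refl
    ... | no n | _ = ⊥-elim (n refl)

    reject-halts : isHalting M (TM.reject M) ≡ true
    reject-halts with TM.reject M ≟F TM.accept M | TM.reject M ≟F TM.reject M
    ... | yes _ | _ = refl
    ... | no _ | yes _ = refl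
    ... | no _ | no n = ⊥-elim (n refl)

    AcceptsWith : Word k → ℤ → List (Fin q) → List (Fin m) → List (Fin m) → Set
    AcceptsWith w α Sq U1 U2 = Σ ℕ λ T → Halted (trun T (initial w)) × (st (trun T (initial w)) ≡ TM.accept M) ×
                        (crossingSeq α (initial w) T ≡ Sq) × SplitContent (tp (trun T (initial w))) α U1 U2

    module _ (u1 u2 c' : Word k) where
      α β sh : ℤ
      α = + suc (length u1)
      β = + suc (length u1 N.+ length u2)
      sh = Z.- (+ length u2)

      β+sh≡α : β + sh ≡ α
      β+sh≡α = ring (+ length u1) (+ length u2)
        where
        ring : ∀ (A B : ℤ) → (1ℤ + (A + B)) + Z.- B ≡ 1ℤ + A
        ring = solve-∀

      pump-accepts : 1 N.≤ length u2 → ∀ Sq U1 U2 Tx →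
        Halted (trun Tx (initial (u1 ++ u2 ++ c'))) → st (trun Tx (initial (u1 ++ u2 ++ c'))) ≡ TM.accept M →
        crossingSeq β (initial (u1 ++ u2 ++ c')) Tx ≡ Sq → crossingSeq α (initial (u1 ++ u2 ++ c')) Tx ≡ Sq →
        SplitContent (tp (trun Tx (initial (u1 ++ u2 ++ c')))) α U1 U2 →
        outputsR (tp (trun Tx (initial (u1 ++ u2 ++ c')))) α (length u2) ≡ [] →
        ∀ j → AcceptsWith (u1 ++ pump u2 c' (suc j)) α Sq U1 U2
      pump-accepts 1≤u2 Sq U1 U2 Tx HX stX csβ csα oX midX zero = Tx , HX , stX , csα , oX
      pump-accepts 1≤u2 Sq U1 U2 Tx HX stX csβ csα oX midX (suc j)
        with pump-accepts 1≤u2 Sq U1 U2 Tx HX stX csβ csα oX midX j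
      ... | (T , HW , stW , csW , oW)
        with CutAndPaste.pasteˡ β α sh β+sh≡α (Tx N.+ T) (initial (u1 ++ u2 ++ pump u2 c' (suc j))) X0 Y Tx T NP.≤-refl
               linv HX HW (trans csβ (sym csW))
        where
        X0 = initial (u1 ++ u2 ++ c')
        Y = initial (u1 ++ pump u2 c' (suc j))
        linv = (refl , refl , initial-glue u1 u2 (pump u2 c' (suc j)) c') , +<+ (N.s≤s N.z≤n) , +<+ (N.s≤s N.z≤n)
      ... | (T' , H' , stE , tpE , csE) =
        T' , H' , Data.Sum.[_,_] (λ e → trans e stX) (λ e → trans e stW) stE , trans (csE α α<β) csα , (lo , ro)
        where
        Cf = trun T' (initial (u1 ++ u2 ++ pump u2 c' (suc j)))
        Xf = trun Tx (initial (u1 ++ u2 ++ c'))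
        Wf = trun T (initial (u1 ++ pump u2 c' (suc j)))
        α<β : α < β
        α<β = +<+ (N.s≤s (NP.m<m+n (length u1) 1≤u2))
        lo : LeftContent (tp Cf) α U1
        lo = leftContent-transfer (tp Xf) (tp Cf) α U1
               (λ p l → sym (trans (tpE p) (glue-l β sh (tp Xf) (tp Wf) p (ZP.<-trans l α<β)))) (proj₁ oX)
        ro' : RightContent (tp Cf) β U2
        ro' = rightContent-shift (tp Cf) (tp Wf) β sh U2 (λ p n → trans (tpE p) (glue-r β sh (tp Xf) (tp Wf) p n))
                (subst (λ z → RightContent (tp Wf) z U2) (sym β+sh≡α) (proj₂ oW))
        mid : outputsR (tp Cf) α (length u2) ≡ []
        mid = trans (outputsR-shift (tp Cf) (tp Xf) α α (length u2)
                      (λ i l → trans (tpE (α + + i)) (glue-l β sh (tp Xf) (tp Wf) _ (+<+ (N.s≤s (NP.+-monoʳ-< (length u1) l))))))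
                    midX
        ro : RightContent (tp Cf) α U2
        ro = rightContent-prepend (tp Cf) α (length u2) [] U2 mid ro'

    accepting-output : ∀ (f : Word k → Maybe (Word m)) → ComputesInLinTime M f → ∀ w α U1 U2 T →
      Halted (trun T (initial w)) → st (trun T (initial w)) ≡ TM.accept M → SplitContent (tp (trun T (initial w))) α U1 U2 →
      f w ≡ just (U1 ++ U2)
    accepting-output f (cc , spec) w α U1 U2 T HT stT oT with spec w
    ... | (tw , _ , res) with run-place tw (initConfig M w) +0
    ... | (z' , eqv) with f w | res
    ... | nothing | r = ⊥-elim (TM.acc≢rej M (sym (trans (sym st2) (trans (cong st (halted-unique tw T (initial w) H2 HT)) stT))))
      where
      st2 : st (trun tw (initial w)) ≡ TM.reject M
      st2 = trans (sym (proj₁ eqv)) r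
      H2 : Halted (trun tw (initial w))
      H2 = trans (cong (isHalting M) st2) reject-halts
    ... | just y | (r1 , r2) = cong just (trans (sym r2) (trans (content-split (Config.state Z) l h rr) tot))
      where
      Z = run M tw (initConfig M w)
      l = Config.lefts Z
      h = Config.head Z
      rr = Config.rights Z
      st2 : st (trun tw (initial w)) ≡ TM.accept M
      st2 = trans (sym (proj₁ eqv)) r1
      H2 : Halted (trun tw (initial w))
      H2 = trans (cong (isHalting M) st2) accept-halts
      same : trun tw (initial w) ≡ trun T (initial w)
      same = halted-unique tw T (initial w) H2 HT
      oZ : SplitContent (tp (trun T (initial w))) z' (outputs (reverse l)) (outputs (h ∷ rr))
      oZ = split-transfer (zipperTape l h rr z') _ z' _ _ (λ p → trans (proj₂ (proj₂ eqv) p) (cong (λ c → tp c p) same)) (zipper-split l h rr z')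
      tot : outputs (reverse l) ++ outputs (h ∷ rr) ≡ U1 ++ U2
      tot = split-total _ z' _ _ α U1 U2 oZ oT


open Pumping

module PumpingAutomaton where

  open import Defs
  open import Data.Nat as N using (ℕ; zero; suc; _≤_; _<_; s≤s; z≤n)
  import Data.Nat.Properties as NP
  open import Data.Fin using (Fin) renaming (_≟_ to _≟F_)
  open import Data.List using (List; []; _∷_; _++_; length; map; lookup; allFin)
  open import Data.List.Properties using (++-assoc; length-++)
  import Data.List.Properties as LP
  open import Data.List.Membership.Propositional using (_∈_)
  open import Data.List.Membership.Propositional.Properties using (∈-allFin)
  open import Data.List.Extrema.Nat using (argmax; f[xs]≤f[argmax])
  import Data.List.Relation.Unary.All as All
  open import Data.List.Relation.Unary.Any as Any using (Any; here; there; index)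
  open import Data.List.Relation.Unary.Any.Properties using (lookup-index; ++⁺ˡ; ++⁺ʳ; map⁺)
  open import Data.Bool using (Bool; true; false; T; _∧_)
  open import Data.Unit using (tt)
  open import Data.Product using (Σ; _×_; _,_; proj₁; proj₂)
  open import Data.Sum using (_⊎_; inj₁; inj₂)
  open import Data.Empty using (⊥-elim)
  open import Relation.Nullary using (¬_; yes; no; Dec)
  open import Relation.Nullary.Decidable using (⌊_⌋)
  open import Relation.Binary.PropositionalEquality
  import Data.Sum

  runS : ∀ {k} {St : Set} → (St → Fin k → St) → St → Word k → St
  runS δ s [] = s
  runS δ s (x ∷ w) = runS δ (δ s x) w

  module FiniteDFA {k : ℕ} {St : Set} (I : St → Set) (univ : List (Σ St I))
    (complete : ∀ s → I s → Any (λ e → proj₁ e ≡ s) univ)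
    (δ' : St → Fin k → St) (pres : ∀ s x → I s → I (δ' s x)) (s0 : St) (i0 : I s0) (fin : St → Bool) where

    run' : St → Word k → St
    run' = runS δ'

    dec : Fin (length univ) → St
    dec i = proj₁ (lookup univ i)

    enc : ∀ s → I s → Fin (length univ)
    enc s i = index (complete s i)

    dec-enc : ∀ s i → dec (enc s i) ≡ s
    dec-enc s i = lookup-index (complete s i)

    Dm : DFA k
    Dm = record { nStates = length univ ; start = enc s0 i0
                ; trans = λ i x → enc (δ' (dec i) x) (pres (dec i) x (proj₂ (lookup univ i)))
                ; final = λ i → fin (dec i) }

    runD : ∀ w i → dec (runDFA Dm i w) ≡ run' (dec i) w
    runD [] i = refl
    runD (x ∷ w) i = trans (runD w _) (cong (λ s → run' s w) (dec-enc _ _))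

    lang→ : ∀ w → langDFA Dm w → T (fin (run' s0 w))
    lang→ w h = subst (λ s → T (fin s)) (trans (runD w (enc s0 i0)) (cong (λ s → run' s w) (dec-enc s0 i0))) h

    lang← : ∀ w → T (fin (run' s0 w)) → langDFA Dm w
    lang← w h = subst (λ s → T (fin s)) (sym (trans (runD w (enc s0 i0)) (cong (λ s → run' s w) (dec-enc s0 i0)))) h

  module BoundedWords (k : ℕ) where
    consAll : List (Fin k) → ∀ {ℓ} → List (Σ (List (Fin k)) (λ xs → length xs ≤ ℓ)) → List (Σ (List (Fin k)) (λ xs → length xs ≤ suc ℓ))
    consAll [] L = []
    consAll (x ∷ xs) L = map (λ e → (x ∷ proj₁ e , s≤s (proj₂ e))) L ++ consAll xs L

    boundedWords : ∀ ℓ → List (Σ (List (Fin k)) (λ xs → length xs ≤ ℓ))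
    boundedWords zero = ([] , z≤n) ∷ []
    boundedWords (suc ℓ) = ([] , z≤n) ∷ consAll (allFin k) (boundedWords ℓ)

    consAll-c : ∀ {x : Fin k} {xs} {ℓ} {ys} {L : List (Σ (List (Fin k)) (λ xs → length xs ≤ ℓ))} →
      x ∈ xs → Any (λ e → proj₁ e ≡ ys) L → Any (λ e → proj₁ e ≡ x ∷ ys) (consAll xs L)
    consAll-c {x} (here refl) a = ++⁺ˡ (map⁺ (Any.map (cong (x ∷_)) a))
    consAll-c {xs = y ∷ xs} (there p) a = ++⁺ʳ (map _ _) (consAll-c p a)

    boundedWords-complete : ∀ ℓ xs → length xs ≤ ℓ → Any (λ e → proj₁ e ≡ xs) (boundedWords ℓ)
    boundedWords-complete zero [] h = here refl
    boundedWords-complete (suc ℓ) [] h = here refl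
    boundedWords-complete (suc ℓ) (x ∷ xs) (s≤s h) = there (consAll-c (∈-allFin x) (boundedWords-complete ℓ xs h))

  pairsΣ : ∀ {A B : Set} {P : A → Set} {Q : B → Set} → List (Σ A P) → List (Σ B Q) → List (Σ (A × B) (λ ab → P (proj₁ ab) × Q (proj₂ ab)))
  pairsΣ [] ys = []
  pairsΣ ((x , px) ∷ xs) ys = map (λ e → ((x , proj₁ e) , (px , proj₂ e))) ys ++ pairsΣ xs ys

  pairsΣ-complete : ∀ {A B : Set} {P : A → Set} {Q : B → Set} {x y} (xs : List (Σ A P)) {ys : List (Σ B Q)} →
    Any (λ e → proj₁ e ≡ x) xs → Any (λ e → proj₁ e ≡ y) ys → Any (λ e → proj₁ e ≡ (x , y)) (pairsΣ xs ys)
  pairsΣ-complete ((x , px) ∷ xs) (here refl) b = ++⁺ˡ (map⁺ (Any.map (cong (x ,_)) b))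
  pairsΣ-complete ((x , px) ∷ xs) {ys} (there a) b = ++⁺ʳ (map _ ys) (pairsΣ-complete xs a b)

  unbounded⇒infinite : ∀ {k} {L : Language k} → (∀ n → Σ (Word k) λ w → L w × n < length w) → Infinite L
  unbounded⇒infinite unbounded (ws , complete) =
    let w , Lw , longer = unbounded (length (argmax length [] ws))
    in NP.<-irrefl refl (NP.<-≤-trans longer (All.lookup (f[xs]≤f[argmax] {f = length} [] ws) (complete w Lw)))

  -- A deterministic automaton for a b⁺ c: the input passes through a buffer of length |c|, and the symbols
  -- leaving it are fed to a matcher for a b⁺; accept when the buffer holds c and a copy of b was just completed.
  module Pumped {k : ℕ} (a b c : Word k) (1≤b : 1 ≤ length b) where
    ℓ = length c
    _≟L_ : (x y : Word k) → Dec (x ≡ y)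
    _≟L_ = LP.≡-dec _≟F_

    data Matcher : Set where
      expectA : Word k → Matcher
      expectB : Word k → Bool → Matcher
      dead : Matcher

    expectingA : Word k → Matcher
    expectingA [] = expectB b false
    expectingA (z ∷ zs) = expectA (z ∷ zs)

    expectingB : Word k → Bool → Matcher
    expectingB [] f = expectB b true
    expectingB (z ∷ zs) f = expectB (z ∷ zs) f

    matchStep : Matcher → Fin k → Matcher
    matchStep (expectA []) y = dead
    matchStep (expectA (z ∷ zs)) y with y ≟F z
    ... | yes _ = expectingA zs
    ... | no _ = dead
    matchStep (expectB [] f) y = dead
    matchStep (expectB (z ∷ zs) f) y with y ≟F z
    ... | yes _ = expectingB zs f
    ... | no _ = dead
    matchStep dead y = dead

    match : Matcher → Word k → Matcher
    match s [] = s
    match s (x ∷ w) = match (matchStep s x) w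

    match-++ : ∀ s u v → match s (u ++ v) ≡ match (match s u) v
    match-++ s [] v = refl
    match-++ s (x ∷ u) v = match-++ (matchStep s x) u v

    match-dead : ∀ w → match dead w ≡ dead
    match-dead [] = refl
    match-dead (x ∷ w) = match-dead w

    matchStep-a : ∀ z zs → matchStep (expectA (z ∷ zs)) z ≡ expectingA zs
    matchStep-a z zs with z ≟F z
    ... | yes _ = refl
    ... | no n = ⊥-elim (n refl)

    matchStep-b : ∀ z zs f → matchStep (expectB (z ∷ zs) f) z ≡ expectingB zs f
    matchStep-b z zs f with z ≟F z
    ... | yes _ = refl
    ... | no n = ⊥-elim (n refl)

    match-a-suffix : ∀ s → match (expectingA s) s ≡ expectB b false
    match-a-suffix [] = refl
    match-a-suffix (z ∷ zs) rewrite matchStep-a z zs = match-a-suffix zs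

    match-b-suffix : ∀ s f → 1 ≤ length s → match (expectB s f) s ≡ expectB b true
    match-b-suffix (z ∷ []) f _ rewrite matchStep-b z [] f = refl
    match-b-suffix (z ∷ z' ∷ zs) f _ = trans (cong (λ s → match s (z' ∷ zs)) (matchStep-b z (z' ∷ zs) f)) (match-b-suffix (z' ∷ zs) f (s≤s z≤n))

    match-power : ∀ n → match (expectB b true) (power b n) ≡ expectB b true
    match-power zero = refl
    match-power (suc n) rewrite match-++ (expectB b true) b (power b n) | match-b-suffix b true 1≤b = match-power n

    match-a-power : ∀ n → match (expectingA a) (a ++ power b (suc n)) ≡ expectB b true
    match-a-power n rewrite match-++ (expectingA a) a (power b (suc n)) | match-a-suffix a | match-++ (expectB b false) b (power b n) | match-b-suffix b false 1≤b = match-power n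

    expectB-injective : ∀ {s s' f f'} → expectB s f ≡ expectB s' f' → (s ≡ s') × (f ≡ f')
    expectB-injective refl = refl , refl

    match-b-suffix⁻¹ : ∀ s f A → 1 ≤ length s → length s ≤ length b → match (expectB s f) A ≡ expectB b true →
         ((A ≡ []) × (s ≡ b) × (f ≡ true)) ⊎ Σ ℕ λ n → A ≡ s ++ power b n
    match-b-suffix⁻¹ s f [] _ _ h = inj₁ (refl , proj₁ (expectB-injective h) , proj₂ (expectB-injective h))
    match-b-suffix⁻¹ (z ∷ zs) f (y ∷ A) l1 l2 h with y ≟F z
    ... | no _ = ⊥-elim (dead≢ (trans (sym (match-dead A)) h))
      where
      dead≢ : ¬ dead ≡ expectB b true
      dead≢ ()
    match-b-suffix⁻¹ (z ∷ []) f (y ∷ A) l1 l2 h | yes refl with match-b-suffix⁻¹ b true A 1≤b NP.≤-refl h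
    ... | inj₁ (e , _ , _) = inj₂ (0 , cong (y ∷_) e)
    ... | inj₂ (n , e) = inj₂ (suc n , cong (y ∷_) e)
    match-b-suffix⁻¹ (z ∷ z' ∷ zs) f (y ∷ A) l1 l2 h | yes refl with match-b-suffix⁻¹ (z' ∷ zs) f A (s≤s z≤n) (NP.≤-trans (NP.n≤1+n _) l2) h
    ... | inj₁ (_ , e , _) = ⊥-elim (NP.<-irrefl (cong length e) l2)
    ... | inj₂ (n , e) = inj₂ (n , cong (y ∷_) e)

    match-a-power⁻¹ : ∀ s A → match (expectingA s) A ≡ expectB b true → Σ ℕ λ n → A ≡ s ++ power b (suc n)
    match-a-power⁻¹ [] A h with match-b-suffix⁻¹ b false A 1≤b NP.≤-refl h
    ... | inj₁ (_ , _ , ())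
    ... | inj₂ (n , e) = n , e
    match-a-power⁻¹ (z ∷ zs) [] ()
    match-a-power⁻¹ (z ∷ zs) (y ∷ A) h with y ≟F z
    ... | no _ = ⊥-elim (dead≢ (trans (sym (match-dead A)) h))
      where
      dead≢ : ¬ dead ≡ expectB b true
      dead≢ ()
    ... | yes refl with match-a-power⁻¹ zs A h
    ... | (n , e) = n , cong (y ∷_) e

    DelayState : Set
    DelayState = List (Fin k) × Matcher

    emit : List (Fin k) → Matcher → DelayState
    emit [] ps = ([] , ps)
    emit (y ∷ rest) ps = (rest , matchStep ps y)

    delayStep : DelayState → Fin k → DelayState
    delayStep (buf , ps) x with length buf N.<? ℓ
    ... | yes _ = (buf ++ x ∷ [] , ps)
    ... | no _ = emit (buf ++ x ∷ []) ps

    matcher₀ : Matcher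
    matcher₀ = expectingA a

    delay₀ : DelayState
    delay₀ = ([] , matcher₀)

    matcherAccepts : Matcher → Bool
    matcherAccepts (expectB s f) = f ∧ ⌊ s ≟L b ⌋
    matcherAccepts _ = false

    delayAccepts : DelayState → Bool
    delayAccepts (buf , ps) = ⌊ buf ≟L c ⌋ ∧ matcherAccepts ps

    unsnoc : ∀ (B0 : Word k) x → Σ (Fin k) λ y → Σ (Word k) λ rest → (B0 ++ x ∷ [] ≡ y ∷ rest) × (length rest ≡ length B0)
    unsnoc [] x = x , [] , refl , refl
    unsnoc (y ∷ B0) x = y , B0 ++ x ∷ [] , refl , trans (length-++ B0) (NP.+-comm _ 1)

    DelayShape : Word k → Word k → Set
    DelayShape A B = (length B ≤ ℓ) × ((A ≡ []) ⊎ (length B ≡ ℓ))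

    delayStep-shape : ∀ A0 B0 x → DelayShape A0 B0 → Σ (Word k) λ A1 → Σ (Word k) λ B1 →
            ((A0 ++ B0) ++ x ∷ [] ≡ A1 ++ B1) × DelayShape A1 B1 × (delayStep (B0 , match matcher₀ A0) x ≡ (B1 , match matcher₀ A1))
    delayStep-shape A0 B0 x (g1 , g2) with length B0 N.<? ℓ
    ... | yes l = A0 , B0 ++ x ∷ [] , ++-assoc A0 B0 _ ,
          (subst (_≤ ℓ) (sym (trans (length-++ B0) (NP.+-comm _ 1))) l ,
           Data.Sum.map (λ e → e) (λ e → ⊥-elim (NP.<-irrefl e l)) g2) , refl
    ... | no n with unsnoc B0 x
    ... | (y , rest , e , le) rewrite e =
          A0 ++ y ∷ [] , rest , trans (++-assoc A0 B0 _) (trans (cong (A0 ++_) e) (sym (++-assoc A0 (y ∷ []) rest))) ,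
          (subst (_≤ ℓ) (sym le) g1 , inj₂ (trans le (NP.≤-antisym g1 (NP.≮⇒≥ n)))) ,
          cong (rest ,_) (sym (match-++ matcher₀ A0 (y ∷ [])))

    delayRun-shape : ∀ w A0 B0 → DelayShape A0 B0 → Σ (Word k) λ A → Σ (Word k) λ B →
          ((A0 ++ B0) ++ w ≡ A ++ B) × DelayShape A B × (runS delayStep (B0 , match matcher₀ A0) w ≡ (B , match matcher₀ A))
    delayRun-shape [] A0 B0 g = A0 , B0 , LP.++-identityʳ _ , g , refl
    delayRun-shape (x ∷ w) A0 B0 g with delayStep-shape A0 B0 x g
    ... | (A1 , B1 , e1 , g1 , e2) with delayRun-shape w A1 B1 g1
    ... | (A , B , e3 , g3 , e4) = A , B ,
          trans (sym (++-assoc (A0 ++ B0) (x ∷ []) w)) (trans (cong (_++ w) e1) e3) , g3 ,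
          trans (cong (λ s → runS delayStep s w) e2) e4

    BoundedMatcher : Matcher → Set
    BoundedMatcher ps = (ps ≡ dead) ⊎ (Σ (Word k) λ s → (ps ≡ expectA s) × (length s ≤ length a)) ⊎
            (Σ (Word k) λ s → Σ Bool λ f → (ps ≡ expectB s f) × (length s ≤ length b))

    BoundedDelay : DelayState → Set
    BoundedDelay st = (length (proj₁ st) ≤ ℓ) × BoundedMatcher (proj₂ st)

    expectingA-bounded : ∀ s → length s ≤ length a → BoundedMatcher (expectingA s)
    expectingA-bounded [] _ = inj₂ (inj₂ (b , false , refl , NP.≤-refl))
    expectingA-bounded (z ∷ zs) h = inj₂ (inj₁ (z ∷ zs , refl , h))

    expectingB-bounded : ∀ s f → length s ≤ length b → BoundedMatcher (expectingB s f)
    expectingB-bounded [] f _ = inj₂ (inj₂ (b , true , refl , NP.≤-refl))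
    expectingB-bounded (z ∷ zs) f h = inj₂ (inj₂ (z ∷ zs , f , refl , h))

    matchStep-bounded : ∀ ps y → BoundedMatcher ps → BoundedMatcher (matchStep ps y)
    matchStep-bounded .dead y (inj₁ refl) = inj₁ refl
    matchStep-bounded .(expectA []) y (inj₂ (inj₁ ([] , refl , h))) = inj₁ refl
    matchStep-bounded .(expectA (z ∷ zs)) y (inj₂ (inj₁ (z ∷ zs , refl , h))) with y ≟F z
    ... | yes _ = expectingA-bounded zs (NP.≤-trans (NP.n≤1+n _) h)
    ... | no _ = inj₁ refl
    matchStep-bounded .(expectB [] f) y (inj₂ (inj₂ ([] , f , refl , h))) = inj₁ refl
    matchStep-bounded .(expectB (z ∷ zs) f) y (inj₂ (inj₂ (z ∷ zs , f , refl , h))) with y ≟F z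
    ... | yes _ = expectingB-bounded zs f (NP.≤-trans (NP.n≤1+n _) h)
    ... | no _ = inj₁ refl

    delayStep-bounded : ∀ s x → BoundedDelay s → BoundedDelay (delayStep s x)
    delayStep-bounded (buf , ps) x (h1 , h2) with length buf N.<? ℓ
    ... | yes l = subst (_≤ ℓ) (sym (trans (length-++ buf) (NP.+-comm _ 1))) l , h2
    ... | no n with unsnoc buf x
    ... | (y , rest , e , le) rewrite e = subst (_≤ ℓ) (sym le) h1 , matchStep-bounded ps y h2

    delay₀-bounded : BoundedDelay delay₀
    delay₀-bounded = z≤n , expectingA-bounded a NP.≤-refl

    open BoundedWords k

    boundedMatchers : List (Σ Matcher BoundedMatcher)
    boundedMatchers = (dead , inj₁ refl) ∷ (map (λ e → (expectA (proj₁ e) , inj₂ (inj₁ (proj₁ e , refl , proj₂ e)))) (boundedWords (length a)) ++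
          (map (λ e → (expectB (proj₁ e) true , inj₂ (inj₂ (proj₁ e , true , refl , proj₂ e)))) (boundedWords (length b)) ++
           map (λ e → (expectB (proj₁ e) false , inj₂ (inj₂ (proj₁ e , false , refl , proj₂ e)))) (boundedWords (length b))))

    boundedMatchers-complete : ∀ ps → BoundedMatcher ps → Any (λ e → proj₁ e ≡ ps) boundedMatchers
    boundedMatchers-complete .dead (inj₁ refl) = here refl
    boundedMatchers-complete .(expectA s) (inj₂ (inj₁ (s , refl , h))) = there (++⁺ˡ (map⁺ (Any.map (cong expectA) (boundedWords-complete _ s h))))
    boundedMatchers-complete .(expectB s true) (inj₂ (inj₂ (s , true , refl , h))) =
      there (++⁺ʳ (map _ (boundedWords (length a))) (++⁺ˡ (map⁺ (Any.map (cong (λ s → expectB s true)) (boundedWords-complete _ s h)))))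
    boundedMatchers-complete .(expectB s false) (inj₂ (inj₂ (s , false , refl , h))) =
      there (++⁺ʳ (map _ (boundedWords (length a))) (++⁺ʳ (map _ (boundedWords (length b))) (map⁺ (Any.map (cong (λ s → expectB s false)) (boundedWords-complete _ s h)))))

    boundedDelays : List (Σ DelayState BoundedDelay)
    boundedDelays = pairsΣ (boundedWords ℓ) boundedMatchers

    boundedDelays-complete : ∀ s → BoundedDelay s → Any (λ e → proj₁ e ≡ s) boundedDelays
    boundedDelays-complete (buf , ps) (h1 , h2) = pairsΣ-complete (boundedWords ℓ) (boundedWords-complete ℓ buf h1) (boundedMatchers-complete ps h2)

    open FiniteDFA BoundedDelay boundedDelays boundedDelays-complete delayStep delayStep-bounded delay₀ delay₀-bounded delayAccepts

    pumpDFA : DFA k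
    pumpDFA = Dm

    delayAccepts-sound : ∀ buf ps → T (delayAccepts (buf , ps)) → (buf ≡ c) × (ps ≡ expectB b true)
    delayAccepts-sound buf ps h with buf ≟L c
    delayAccepts-sound buf (expectB s true) h | yes e with s ≟L b
    ... | yes e' = e , cong (λ x → expectB x true) e'
    delayAccepts-sound buf (expectB s false) () | yes e
    delayAccepts-sound buf (expectA _) () | yes e
    delayAccepts-sound buf dead () | yes e

    delayAccepts-complete : T (delayAccepts (c , expectB b true))
    delayAccepts-complete with c ≟L c | b ≟L b
    ... | yes _ | yes _ = tt
    ... | no n | _ = ⊥-elim (n refl)
    ... | yes _ | no n = ⊥-elim (n refl)

    ++-injective-length : ∀ (A B A' B' : Word k) → A ++ B ≡ A' ++ B' → length B ≡ length B' → (A ≡ A') × (B ≡ B')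
    ++-injective-length [] B [] B' e l = refl , e
    ++-injective-length [] B (x ∷ A') B' e l = ⊥-elim (NP.<-irrefl (sym l) (subst (length B' N.<_) (sym (cong length e))
                                       (s≤s (subst (length B' ≤_) (sym (length-++ A')) (NP.m≤n+m _ _)))))
    ++-injective-length (x ∷ A) B [] B' e l = ⊥-elim (NP.<-irrefl l (subst (length B N.<_) (cong length e)
                                       (s≤s (subst (length B ≤_) (sym (length-++ A)) (NP.m≤n+m _ _)))))
    ++-injective-length (x ∷ A) B (y ∷ A') B' e l with LP.∷-injective e
    ... | (refl , e') with ++-injective-length A B A' B' e' l
    ... | (r1 , r2) = cong (x ∷_) r1 , r2

    accepted⇒pumped : ∀ w → langDFA Dm w → Σ ℕ λ n → w ≡ a ++ (power b (suc n) ++ c)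
    accepted⇒pumped w h with delayRun-shape w [] [] (z≤n , inj₁ refl)
    ... | (A , B , e , g , er) with delayAccepts-sound B (match matcher₀ A) (subst (λ s → T (delayAccepts s)) er (lang→ w h))
    ... | (e1 , e2) with match-a-power⁻¹ a A e2
    ... | (n , e3) = n , trans e (trans (cong₂ _++_ e3 e1) (++-assoc a (power b (suc n)) c))

    length-power : ∀ n → n ≤ length (power b n)
    length-power zero = z≤n
    length-power (suc n) = subst (suc n ≤_) (sym (length-++ b)) (NP.+-mono-≤ 1≤b (length-power n))

    accepts-pumped : ∀ n → langDFA Dm (a ++ (power b (suc n) ++ c))
    accepts-pumped n with delayRun-shape (a ++ (power b (suc n) ++ c)) [] [] (z≤n , inj₁ refl)
    ... | (A , B , e , (g1 , g2) , er) = lang← (a ++ (power b (suc n) ++ c)) (subst (λ s → T (delayAccepts s)) (sym er) fc)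
      where
      w = a ++ (power b (suc n) ++ c)
      lw : suc ℓ ≤ length w
      lw = subst (suc ℓ ≤_) (sym (trans (length-++ a) (cong (length a N.+_) (length-++ (power b (suc n))))))
             (NP.≤-trans (NP.+-monoˡ-≤ ℓ (NP.≤-trans (s≤s z≤n) (length-power (suc n)))) (NP.m≤n+m _ (length a)))
      lB' : (A ≡ []) ⊎ (length B ≡ ℓ) → length B ≡ ℓ
      lB' (inj₂ x) = x
      lB' (inj₁ eA) = ⊥-elim (NP.<-irrefl refl (NP.<-≤-trans (NP.≤-trans lw (NP.≤-reflexive (trans (cong length e) (cong (λ X → length (X ++ B)) eA)))) g1))
      lB : length B ≡ ℓ
      lB = lB' g2
      sp = ++-injective-length (a ++ power b (suc n)) c A B (trans (++-assoc a _ c) e) (sym lB)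
      fc : T (delayAccepts (B , match matcher₀ A))
      fc = subst₂ (λ x y → T (delayAccepts (x , y))) (proj₂ sp) (trans (sym (match-a-power n)) (cong (match matcher₀) (proj₁ sp))) delayAccepts-complete

    longer : ∀ n → n < length (a ++ power b (suc n) ++ c)
    longer n = NP.<-≤-trans (length-power (suc n))
      (subst (length (power b (suc n)) ≤_) (sym (length-++ a))
        (NP.≤-trans (subst (length (power b (suc n)) ≤_) (sym (length-++ (power b (suc n)))) (NP.m≤m+n _ _))
          (NP.m≤n+m _ _)))

    infinite : Infinite (langDFA pumpDFA)
    infinite = unbounded⇒infinite (λ n → a ++ power b (suc n) ++ c , accepts-pumped n , longer n)

  pumped-family⇒regular-subset : ∀ {k} {L : Language k} (a b c : Word k) → 1 ≤ length b →
    (∀ n → L (a ++ power b (suc n) ++ c)) → Σ (DFA k) λ D → (langDFA D ⊆L L) × Infinite (langDFA D)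
  pumped-family⇒regular-subset {L = L} a b c 1≤b pumped = pumpDFA , autoD⊆L , infinite
    where
    open Pumped a b c 1≤b
    autoD⊆L : langDFA pumpDFA ⊆L L
    autoD⊆L w w∈ with accepted⇒pumped w w∈
    ... | n , refl = pumped n


open PumpingAutomaton

module DFAReduction where

  open import Defs
  open import Data.Nat using (ℕ; zero; suc; _+_; _*_; _≤_; s≤s; z≤n)
  open import Data.Fin using (Fin; zero; suc)
  open import Data.List using (List; []; _∷_; _++_; map; length)
  open import Data.Maybe using (Maybe; just; nothing)
  open import Data.Bool using (true; false; if_then_else_)
  open import Data.Product using (Σ; _×_; _,_; proj₁; proj₂)
  open import Data.Unit using (⊤; tt)
  open import Data.Empty using (⊥-elim)
  open import Relation.Nullary using (¬_)
  open import Relation.Binary.PropositionalEquality using (_≡_; refl; trans; cong; subst₂)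
  open import Data.Nat.Tactic.RingSolver using (solve-∀)
  open import Data.Nat.Properties using (m≤m+n; +-monoʳ-≤)

  module FromDFA {k : ℕ} (D : DFA k) where
    open DFA D renaming (start to dstart; trans to dtrans; final to dfinal; nStates to n)

    -- State 0 starts, 1 accepts, 2 rejects, and 3 + s scans the input while D is in state s.
    Q : ℕ
    Q = suc (suc (suc n))

    S : Set
    S = Sym k 0 0

    running : Fin n → Fin Q
    running s = suc (suc (suc s))

    accQ rejQ : Fin Q
    accQ = suc zero
    rejQ = suc (suc zero)

    verdict : Fin n → Fin Q
    verdict s = if dfinal s then accQ else rejQ

    δ : Fin Q → S → Fin Q × S × Move
    δ zero lend = running dstart , lend , right
    δ zero _ = rejQ , blank , stay
    δ (suc zero) _ = rejQ , blank , stay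
    δ (suc (suc zero)) _ = rejQ , blank , stay
    δ (suc (suc (suc s))) (inp a) = running (dtrans s a) , inp a , right
    δ (suc (suc (suc s))) rend = verdict s , rend , stay
    δ (suc (suc (suc s))) _ = rejQ , blank , stay

    M : TM k 0 0 Q
    M = record { start = zero ; accept = accQ ; reject = rejQ ; acc≢rej = λ () ; δ = δ }

    scanning : Word k → Fin n → List S → Config k 0 0 Q
    scanning [] s l = cfg (running s) l rend []
    scanning (a ∷ w) s l = cfg (running s) l (inp a) (map inp w ++ (rend ∷ []))

    step-initial : ∀ x → step M (initConfig M x) ≡ scanning x dstart (lend ∷ [])
    step-initial [] = refl
    step-initial (a ∷ x) = refl

    step-scanning : ∀ a w s l → step M (scanning (a ∷ w) s l) ≡ scanning w (dtrans s a) (inp a ∷ l)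
    step-scanning a [] s l = refl
    step-scanning a (b ∷ w) s l = refl

    run-+ : ∀ m n c → run M (m + n) c ≡ run M n (run M m c)
    run-+ zero n c = refl
    run-+ (suc m) n c = run-+ m n (step M c)

    run-scanning : ∀ w s l → Σ (List S) λ l' → run M (length w) (scanning w s l) ≡ scanning [] (runDFA D s w) l'
    run-scanning [] s l = l , refl
    run-scanning (a ∷ w) s l with run-scanning w (dtrans s a) (inp a ∷ l)
    ... | l' , eq = l' , trans (cong (run M (length w)) (step-scanning a w s l)) eq

    f : Word k → Maybe (Word 0)
    f x = if dfinal (runDFA D dstart x) then just [] else nothing

    noWords-over-Fin0 : (w : Word 0) → w ≡ []
    noWords-over-Fin0 [] = refl
    noWords-over-Fin0 (() ∷ _)

    verdict-result : ∀ s l → Result M (step M (scanning [] s l)) (if dfinal s then just [] else nothing)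
    verdict-result s l with dfinal s
    ... | true = refl , noWords-over-Fin0 _
    ... | false = refl

    time-bound : ∀ m → suc (m + 1) ≤ 2 * suc m
    time-bound m = subst₂ _≤_ (lhs m) (rhs m) (+-monoʳ-≤ 2 (m≤m+n m m))
      where
      lhs : ∀ m → 2 + m ≡ suc (m + 1)
      lhs = solve-∀
      rhs : ∀ m → 2 + (m + m) ≡ 2 * suc m
      rhs = solve-∀

    comp : 1-FLIN-partial f
    comp = 0 , Q , M , 2 , λ x → suc (length x + 1) , time-bound (length x) , res x
      where
      res : ∀ x → Result M (run M (suc (length x + 1)) (initConfig M x)) (f x)
      res x with run-scanning x dstart (lend ∷ [])
      ... | l' , eq rewrite step-initial x | run-+ (length x) 1 (scanning x dstart (lend ∷ [])) | eq = verdict-result (runDFA D dstart x) l'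

    defined⇒accepted : ∀ x y → f x ≡ just y → langDFA D x
    defined⇒accepted x y eq with dfinal (runDFA D dstart x)
    ... | true = tt
    ... | false with eq
    ... | ()

    accepted⇒defined : ∀ x → langDFA D x → f x ≡ just []
    accepted⇒defined x h with dfinal (runDFA D dstart x)
    ... | true = refl
    ... | false = ⊥-elim h


open DFAReduction

open import Data.Nat as N using (zero; suc; _+_; _*_; _≤_; _<_; s≤s; z≤n)
import Data.Nat.Properties as NP
open import Data.Integer as Z using (ℤ; +_; +0)
open import Data.Fin using (Fin)
open import Data.List using (List; []; _∷_; _++_; reverse; length; cartesianProduct)
open import Data.List.Properties using (length-++; ++-identityʳ-unique)
open import Data.List.Membership.Propositional using (_∈_)
open import Data.List.Membership.Propositional.Properties using (∈-cartesianProduct⁺)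
open import Data.Maybe using (Maybe; just)
open import Data.Unit using (⊤; tt)
open import Data.Product using (Σ; _,_; proj₁; proj₂)
open import Relation.Nullary using (¬_)
open import Relation.Binary.PropositionalEquality
open import Function.Bundles using (mk⇔)

splitAt-length : ∀ {A : Set} (xs : List A) {j} → j ≤ length xs →
  Σ (List A) λ b → Σ (List A) λ c → (xs ≡ b ++ c) × (length b ≡ j)
splitAt-length xs {zero} _ = [] , xs , refl , refl
splitAt-length (x ∷ xs) {suc j} (s≤s j≤) with splitAt-length xs j≤
... | b , c , refl , refl = x ∷ b , c , refl , refl

splitAt-lengths : ∀ {A : Set} (xs : List A) {i j} → i ≤ j → j ≤ length xs →
  Σ (List A) λ a → Σ (List A) λ b → Σ (List A) λ c →
    (xs ≡ a ++ b ++ c) × (length a ≡ i) × (length a + length b ≡ j)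
splitAt-lengths xs {zero} z≤n j≤ with splitAt-length xs j≤
... | b , c , refl , refl = [] , b , c , refl , refl , refl
splitAt-lengths (x ∷ xs) {suc i} (s≤s i≤j) (s≤s j≤) with splitAt-lengths xs i≤j j≤
... | a , b , c , refl , refl , refl = x ∷ a , b , c , refl , refl , refl

module LinearTimePumping {k m na q : ℕ} (M : TM k m na q) (f : Word k → Maybe (Word m))
                         (comp : ComputesInLinTime M f) (u : Word m) where
  open IntegerTape M
  open Zipper M
  open Content M
  open Run M

  c : ℕ
  c = proj₁ comp

  record AcceptingRun (x : Word k) : Set where
    field
      time        : ℕ
      fast        : time ≤ c * suc (length x)
      halts       : Halted (trun time (initial x))
      accepts     : st (trun time (initial x)) ≡ TM.accept M
      outputSplit : ∀ b → Σ (Word m) λ U₁ → Σ (Word m) λ U₂ →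
                      SplitContent (tp (trun time (initial x))) b U₁ U₂ × (U₁ ++ U₂ ≡ u)

  acceptingRun : ∀ x → f x ≡ just u → AcceptingRun x
  acceptingRun x fx = fromResult (proj₂ comp x)
    where
    fromResult : (Σ ℕ λ t → (t ≤ c * suc (length x)) × Result M (run M t (initConfig M x)) (f x)) → AcceptingRun x
    fromResult (t , t≤ , result) = record
      { time = t ; fast = t≤ ; halts = trans (cong (isHalting M) accepted) accept-halts
      ; accepts = accepted ; outputSplit = splitAt }
      where
      C : Config k m na q
      C = run M t (initConfig M x)
      z : ℤ
      z = proj₁ (run-place t (initConfig M x) +0)
      simulated : place C z ≈ trun t (initial x)
      simulated = proj₂ (run-place t (initConfig M x) +0)
      result′ : Result M C (just u)
      result′ = subst (Result M C) fx result
      accepted : st (trun t (initial x)) ≡ TM.accept M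
      accepted = trans (sym (proj₁ simulated)) (proj₁ result′)
      split : SplitContent (tp (trun t (initial x))) z
                (outputs (reverse (Config.lefts C))) (outputs (Config.head C ∷ Config.rights C))
      split = split-transfer (zipperTape (Config.lefts C) (Config.head C) (Config.rights C) z) (tp (trun t (initial x))) z _ _
                (proj₂ (proj₂ simulated)) (zipper-split (Config.lefts C) (Config.head C) (Config.rights C) z)
      splitAt : ∀ b → Σ (Word m) λ U₁ → Σ (Word m) λ U₂ →
                  SplitContent (tp (trun t (initial x))) b U₁ U₂ × (U₁ ++ U₂ ≡ u)
      splitAt b =
        let U₁ , U₂ , splitb , eq = split-anywhere (tp (trun t (initial x))) z _ _ b split
        in U₁ , U₂ , splitb ,
           trans (sym eq) (trans (sym (content-split (Config.state C) (Config.lefts C) (Config.head C) (Config.rights C))) (proj₂ result′))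

  open AcceptingRun

  -- Boundary + suc i separates the first i input symbols from the rest (cell 0 holds ¢).
  boundaryKey : ∀ {x} → AcceptingRun x → ℕ → List (Fin q) × Word m
  boundaryKey {x} R i = crossingSeq (+ suc i) (initial x) (time R) ,
                        outputsR (tp (trun (time R) (initial x))) (+ 1) i

  Keys : List (List (Fin q) × Word m)
  Keys = cartesianProduct (wordsUpTo q (suc (c + c))) (wordsUpTo m (length u))

  repeated-boundary : ∀ x (R : AcceptingRun x) → 2 * length Keys ≤ length x →
    Σ ℕ λ i → Σ ℕ λ j → (i < j) × (j ≤ length x) × (boundaryKey R i ≡ boundaryKey R j)
  repeated-boundary x R long =
    let i , j , i<j , j<suc , same =
          repeatedShortKey Keys (boundaryKey R) crossings c (suc (length x)) short∈Keys budget (s≤s long)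
    in i , j , i<j , NP.≤-pred j<suc , same
    where
    crossings : ℕ → ℕ
    crossings i = length (crossingSeq (+ suc i) (initial x) (time R))
    budget : sumBelow crossings (suc (length x)) ≤ c * suc (length x)
    budget = NP.≤-trans (sumBelow-crossingSeq (time R) (initial x) (suc (length x))) (fast R)
    outputs≤u : ∀ i → length (outputsR (tp (trun (time R) (initial x))) (+ 1) i) ≤ length u
    outputs≤u i =
      let U₁ , U₂ , (_ , rightOfBoundary) , U₁U₂≡u = outputSplit R (+ 1)
      in NP.≤-trans (outputsR-length _ _ U₂ rightOfBoundary i)
           (subst (length U₂ ≤_) (trans (sym (length-++ U₁)) (cong length U₁U₂≡u)) (NP.m≤n+m _ _))
    short∈Keys : ∀ i → crossings i ≤ suc (c + c) → boundaryKey R i ∈ Keys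
    short∈Keys i short = ∈-cartesianProduct⁺ (∈-wordsUpTo _ _ short) (∈-wordsUpTo _ _ (outputs≤u i))

  -- Equal output prefixes at the two boundaries mean that nothing is output in between.
  repeated-boundary-pumps : ∀ a b c′ (R : AcceptingRun (a ++ b ++ c′)) → 1 ≤ length b →
    boundaryKey R (length a) ≡ boundaryKey R (length a + length b) →
    ∀ n → f (a ++ power b (suc n) ++ c′) ≡ just u
  repeated-boundary-pumps a b c′ R 1≤b same n =
    let U₁ , U₂ , split , U₁U₂≡u = outputSplit R (+ suc (length a))
        t , halted , accepted , _ , splitₙ =
          pump-accepts a b c′ 1≤b _ U₁ U₂ (time R) (halts R) (accepts R) (sym (cong proj₁ same)) refl split silent n
    in trans (cong (λ w → f (a ++ w)) (sym (pump≡power++ b c′ (suc n))))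
             (trans (accepting-output f comp _ _ U₁ U₂ t halted accepted splitₙ) (cong just U₁U₂≡u))
    where
    T = tp (trun (time R) (initial (a ++ b ++ c′)))
    silent : outputsR T (+ suc (length a)) (length b) ≡ []
    silent = ++-identityʳ-unique _ (trans (cong proj₂ same) (outputsR-+ T (+ 1) (length a) (length b)))

  long-pumpable : ∀ x → f x ≡ just u → 2 * length Keys ≤ length x →
    Σ (Word k) λ a → Σ (Word k) λ b → Σ (Word k) λ c′ →
      (1 ≤ length b) × (∀ n → f (a ++ power b (suc n) ++ c′) ≡ just u)
  long-pumpable x fx long = fromBoundaries (acceptingRun x fx) (repeated-boundary x (acceptingRun x fx) long)
    where
    cutAt : ∀ {x i j} (R : AcceptingRun x) → i < j → boundaryKey R i ≡ boundaryKey R j →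
      (Σ (Word k) λ a → Σ (Word k) λ b → Σ (Word k) λ c′ →
        (x ≡ a ++ b ++ c′) × (length a ≡ i) × (length a + length b ≡ j)) →
      Σ (Word k) λ a → Σ (Word k) λ b → Σ (Word k) λ c′ →
        (1 ≤ length b) × (∀ n → f (a ++ power b (suc n) ++ c′) ≡ just u)
    cutAt R i<j same (a , b , c′ , refl , refl , refl) = a , b , c′ , 1≤b , repeated-boundary-pumps a b c′ R 1≤b same
      where
      1≤b : 1 ≤ length b
      1≤b = NP.+-cancelˡ-< (length a) 0 _ (subst (_< length a + length b) (sym (NP.+-identityʳ _)) i<j)
    fromBoundaries : (R : AcceptingRun x) →
      (Σ ℕ λ i → Σ ℕ λ j → (i < j) × (j ≤ length x) × (boundaryKey R i ≡ boundaryKey R j)) →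
      Σ (Word k) λ a → Σ (Word k) λ b → Σ (Word k) λ c′ →
        (1 ≤ length b) × (∀ n → f (a ++ power b (suc n) ++ c′) ≡ just u)
    fromBoundaries R (i , j , i<j , j≤ , same) = cutAt R i<j same (splitAt-lengths x (NP.<⇒≤ i<j) j≤)

immune⇒finite-preimages : ∀ {k m} {L : Language k} {B : Language m} {f} → REG-immune L →
  Quasireduction L B f → ∀ u → B u → Finite (preimage f u)
immune⇒finite-preimages {k} {L = L} {f = f} (_ , noRegularSubset) ((_ , _ , M , comp) , reduces) u Bu =
  wordsUpTo k (2 * length Keys) , λ x fx → ∈-wordsUpTo _ x (NP.≮⇒≥ (λ long → unpumpable (long-pumpable x fx (NP.<⇒≤ long))))
  where
  open LinearTimePumping M f comp u
  unpumpable : ¬ (Σ (Word k) λ a → Σ (Word k) λ b → Σ (Word k) λ c′ →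
                    (1 ≤ length b) × (∀ n → f (a ++ power b (suc n) ++ c′) ≡ just u))
  unpumpable (a , b , c′ , 1≤b , pumped) =
    noRegularSubset (pumped-family⇒regular-subset a b c′ 1≤b (λ n → proj₂ (reduces _ u (pumped n)) Bu))

finite-preimages⇒immune : ∀ {k} {L : Language k} → Infinite L →
  (∀ (m : ℕ) (B : Language m) f → Quasireduction L B f → ∀ u → B u → Finite (preimage f u)) →
  REG-immune L
finite-preimages⇒immune {L = L} infinite finitePreimages = infinite , λ (D , D⊆L , infiniteD) →
  let open FromDFA D
      -- f is defined exactly on L(D) ⊆ L, so it reduces L to the full language over the empty alphabet.
      reduction = comp , λ x y fx → (λ _ → tt) , (λ _ → D⊆L x (defined⇒accepted x y fx))
      (ws , complete) = finitePreimages 0 (λ _ → ⊤) f reduction [] tt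
  in infiniteD (ws , λ w w∈D → complete w (accepted⇒defined w w∈D))

lemma4p2 : (k : ℕ) (L : Language k) →
    REG-immune L ⇔
      (Infinite L × (∀ (m : ℕ) (B : Language m) f → Quasireduction L B f →
                       ∀ u → B u → Finite (preimage f u)))
lemma4p2 k L = mk⇔ (λ immune → proj₁ immune , λ m B f → immune⇒finite-preimages immune)
                   (λ (infinite , finitePreimages) → finite-preimages⇒immune infinite finitePreimages)
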